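{- The set of Catalan trees is in record duality with $\mathcal{PF}_{0-2}$, i.e. $\{\pi_T: T\text{ Catalan}\}=\mathcal{PF}_{0-2}$. Consequently $$\sum_{T\text{ Catalan}} y^{\mathrm{wait}(T)}z^{\mathrm{psa}(T)}t^{\deg_\circ(T)}w_0^{\mathrm{leaves}(T)}w_2^{n-\mathrm{leaves}(T)}q^{\mathrm{ord}(T)}=\sum_{\pi\in\mathcal{PF}_{0-2}} y^{\mathrm{probes}(\pi)}z^{\mathrm{lucky}(\pi)}t^{\mathrm{ones}(\pi)}w_0^{\mathrm{abs}(\pi)}w_2^{n-\mathrm{abs}(\pi)}q^{\mathrm{len}(\pi)},$$ where in each summand $n=\mathrm{ord}(T)$, respectively $n=\mathrm{len}(\pi)$.
   Context: Cayley trees: trees on $[n]_0=\{0,\dots,n\}$ ($n\ge0$) rooted at $0$, parent map $f_T$. A Catalan tree is a Cayley tree in which every vertex (root included) has either $0$ or $2$ children. $\mathrm{leaves}(T)$ = number of vertices with no children. Weary permutation $\omega_T$: priority-first search from $0$ (visit at each step the smallest unvisited vertex adjacent to a visited one); $\omega_T(i)$ = $i$-th non-root vertex visited, $\omega_T(0)=0$. Preference sequence $\pi_T(i)=\omega_T^{ -1}(f_T(i))+1$. $\mathrm{pt}(T)$ is $T$ with each $v$ relabelled $\omega_T^{ -1}(v)$. $\mathrm{ord}(T)=n$; $\deg_\circ(T)$ = number of children of $0$; $\mathrm{wait}(T)=\sum_{i=1}^n(i-f_{\mathrm{pt}(T)}(i))$; $\mathrm{psa}(T)=\#\{i: f_{\mathrm{pt}(T)}(i)=i-1\}$.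 Parking function $\pi=(a_1,\dots,a_n)$, $a_i\in[n]$: cars $1,\dots,n$ enter in order a street with spots $1,\dots,n$, car $i$ parks in the first free spot $j\ge a_i$, and all cars park. $\mathcal{PF}_{0-2}$ is the set of parking functions (of any length) in which every symbol of $[n+1]$ appears $0$ or $2$ times. $\mathrm{len}(\pi)=n$; $\mathrm{lucky}(\pi)$ = number of cars parking in their preferred spot; $\mathrm{probes}(\pi)=n+\sum(\text{final spot}-\text{preferred spot})$; $\mathrm{ones}(\pi)=\#\{i:a_i=1\}$; $\mathrm{abs}(\pi)$ = number of elements of $[n+1]$ not appearing in $\pi$. -}

module Defs where

open import Data.Nat using (ℕ; zero; suc; _+_; _∸_; _≡ᵇ_; _≤ᵇ_)
open import Data.Bool using (Bool; true; false; _∧_; _∨_; not; if_then_else_)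
open import Data.List using (List; []; _∷_; length; map; filterᵇ; upTo; concatMap; _++_)
open import Data.Bool.ListAction using (any; all)
open import Data.Nat.ListAction using (sum)
open import Data.Vec using (Vec; []; _∷_; toList)
import Data.Vec as V
open import Data.Maybe using (Maybe; just; nothing)

countᵇ : {A : Set} → (A → Bool) → List A → ℕ
countᵇ p xs = length (filterᵇ p xs)

elemᵇ : ℕ → List ℕ → Bool
elemᵇ x xs = any (λ y → x ≡ᵇ y) xs

-- 0-based position of x in xs (length xs if absent)
indexOf : ℕ → List ℕ → ℕ
indexOf x []       = 0
indexOf x (y ∷ ys) = if x ≡ᵇ y then 0 else suc (indexOf x ys)

-- k-th element (0-based), default 0
nth : List ℕ → ℕ → ℕ
nth []       _       = 0
nth (x ∷ xs) zero    = x
nth (x ∷ xs) (suc k) = nth xs k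

allVecs : List ℕ → (k : ℕ) → List (Vec ℕ k)
allVecs s zero    = [] ∷ []
allVecs s (suc k) = concatMap (λ x → map (x ∷_) (allVecs s k)) s

-- [a, b] as a list  (b ∸ a + 1 elements starting at a)
range : ℕ → ℕ → List ℕ
range a b = map (a +_) (upTo (suc b ∸ a))

-- Cayley trees on [n]₀ = {0,…,n} rooted at 0, given by the parent map.
-- A candidate tree of order n is  f : Vec ℕ n , where the i-th entry
-- (0-based) is f_T(i+1), the parent of vertex i+1.

parentOf : {n : ℕ} → Vec ℕ n → ℕ → ℕ
parentOf f zero    = 0
parentOf f (suc v) = nth (toList f) v

iter : ℕ → (ℕ → ℕ) → ℕ → ℕ
iter zero    g x = x
iter (suc k) g x = iter k g (g x)

-- f is the parent map of a Cayley tree on [n]₀ rooted at 0: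
-- every parent lies in [n]₀ and every vertex reaches the root 0 by
-- following parents (a path to the root has at most n edges).
isCayley : {n : ℕ} → Vec ℕ n → Bool
isCayley {n} f =
  all (λ p → p ≤ᵇ n) (toList f) ∧
  all (λ v → iter n (parentOf f) v ≡ᵇ 0) (upTo (suc n))

children : {n : ℕ} → Vec ℕ n → ℕ → ℕ
children f v = countᵇ (λ p → p ≡ᵇ v) (toList f)

isCatalan : {n : ℕ} → Vec ℕ n → Bool
isCatalan {n} f =
  isCayley f ∧
  all (λ v → (children f v ≡ᵇ 0) ∨ (children f v ≡ᵇ 2)) (upTo (suc n))

allParentMaps : (n : ℕ) → List (Vec ℕ n)
allParentMaps n = allVecs (upTo (suc n)) n

-- Weary permutation: priority-first search from 0.

adjacent : {n : ℕ} → Vec ℕ n → ℕ → ℕ → Bool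
adjacent f u v =
  (not (u ≡ᵇ 0) ∧ (parentOf f u ≡ᵇ v)) ∨ (not (v ≡ᵇ 0) ∧ (parentOf f v ≡ᵇ u))

nextVertex : {n : ℕ} → Vec ℕ n → List ℕ → Maybe ℕ
nextVertex {n} f vis with filterᵇ (λ w → not (elemᵇ w vis) ∧ any (adjacent f w) vis) (upTo (suc n))
... | []    = nothing
... | w ∷ _ = just w

search : {n : ℕ} → Vec ℕ n → ℕ → List ℕ → List ℕ
search f zero    vis = vis
search f (suc k) vis with nextVertex f vis
... | nothing = vis
... | just w  = search f k (vis ++ (w ∷ []))

-- ω_T listed as (ω_T(0), ω_T(1), …, ω_T(n)) with ω_T(0) = 0
weary : {n : ℕ} → Vec ℕ n → List ℕ
weary {n} f = search f n (0 ∷ [])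

weary⁻¹ : {n : ℕ} → Vec ℕ n → ℕ → ℕ
weary⁻¹ f v = indexOf v (weary f)

prefSeq : {n : ℕ} → Vec ℕ n → Vec ℕ n
prefSeq f = V.map (λ p → suc (weary⁻¹ f p)) f

-- parent map of pt(T): f_pt(T)(i) = ω⁻¹(f_T(ω(i)))
ptParent : {n : ℕ} → Vec ℕ n → ℕ → ℕ
ptParent f i = weary⁻¹ f (parentOf f (nth (weary f) i))

ord : {n : ℕ} → Vec ℕ n → ℕ
ord {n} f = n

degRoot : {n : ℕ} → Vec ℕ n → ℕ
degRoot f = children f 0

leaves : {n : ℕ} → Vec ℕ n → ℕ
leaves {n} f = countᵇ (λ v → children f v ≡ᵇ 0) (upTo (suc n))

wait : {n : ℕ} → Vec ℕ n → ℕ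
wait {n} f = sum (map (λ i → i ∸ ptParent f i) (range 1 n))

psa : {n : ℕ} → Vec ℕ n → ℕ
psa {n} f = countᵇ (λ i → ptParent f i ≡ᵇ (i ∸ 1)) (range 1 n)

firstFree : ℕ → ℕ → ℕ → List ℕ → Maybe ℕ
firstFree n zero       j occ = nothing
firstFree n (suc fuel) j occ =
  if j ≤ᵇ n then (if elemᵇ j occ then firstFree n fuel (suc j) occ else just j)
            else nothing

parkList : ℕ → List ℕ → List ℕ → Maybe (List ℕ)
parkList n occ []       = just []
parkList n occ (a ∷ as) with firstFree n (suc n) a occ
... | nothing = nothing
... | just j  with parkList n (j ∷ occ) as
...   | nothing = nothing
...   | just js = just (j ∷ js)

parking : {n : ℕ} → Vec ℕ n → Maybe (List ℕ)
parking {n} π = parkList n [] (toList π)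

isPF : {n : ℕ} → Vec ℕ n → Bool
isPF {n} π with parking π
... | nothing = false
... | just _  = all (λ a → (1 ≤ᵇ a) ∧ (a ≤ᵇ n)) (toList π)

occ : {n : ℕ} → Vec ℕ n → ℕ → ℕ
occ π k = countᵇ (λ a → a ≡ᵇ k) (toList π)

isPF02 : {n : ℕ} → Vec ℕ n → Bool
isPF02 {n} π = isPF π ∧ all (λ k → (occ π k ≡ᵇ 0) ∨ (occ π k ≡ᵇ 2)) (range 1 (suc n))

allPrefSeqs : (n : ℕ) → List (Vec ℕ n)
allPrefSeqs n = allVecs (range 1 n) n

len : {n : ℕ} → Vec ℕ n → ℕ
len {n} π = n


lucky : {n : ℕ} → Vec ℕ n → ℕ
lucky π with parking π
... | nothing = 0
... | just js = go (toList π) js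
  where
  go : List ℕ → List ℕ → ℕ
  go (a ∷ as) (j ∷ js) = (if a ≡ᵇ j then 1 else 0) + go as js
  go _ _ = 0

probes : {n : ℕ} → Vec ℕ n → ℕ
probes {n} π with parking π
... | nothing = 0
... | just js = n + go (toList π) js
  where
  go : List ℕ → List ℕ → ℕ
  go (a ∷ as) (j ∷ js) = (j ∸ a) + go as js
  go _ _ = 0

ones : {n : ℕ} → Vec ℕ n → ℕ
ones π = occ π 1

abs : {n : ℕ} → Vec ℕ n → ℕ
abs {n} π = countᵇ (λ k → occ π k ≡ᵇ 0) (range 1 (suc n))

{-# OPTIONS --safe #-}
module Submission where

-- Give car i the preference 1 + ω⁻¹(parent of i), where ω is the weary order of the tree.
-- Car i then parks exactly at spot ω⁻¹(i): a vertex visited after the parent of i but before i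
-- is smaller than i (otherwise the search would have chosen i first), so its car came earlier
-- and holds that spot. Reading the parking process off the tree, lucky cars are the steps
-- f(i) = i − 1 of pt(T) and probes are waits; the symbol 1 + ω⁻¹(v) occurs as often as v has
-- children, which matches ones with the root degree and unused symbols with leaves, and makes
-- T Catalan iff π_T ∈ PF₀₋₂.
-- Conversely, for a parking function let the parent of car i be the car parked at spot a_i − 1
-- (the root for spot 0). Spots strictly decrease towards the root, so this is a tree, and by
-- strong induction its weary order visits the cars in spot order, which gives back the
-- preference sequence. Each map sends one filtered enumeration into the other and is undone
-- by the other map, so the counts agree.

open import Defs
open import Data.Bool using (Bool; true; false; _∧_; _∨_; not; if_then_else_; T)
open import Data.Bool.ListAction using (any; all)
open import Data.Bool.Properties using (T-≡)
open import Data.Empty using (⊥; ⊥-elim)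
open import Data.List using (List; []; _∷_; length; map; filterᵇ; upTo; applyUpTo; concatMap; zipWith; _++_; [_])
open import Data.List.Membership.Propositional using (_∈_; _∉_)
open import Data.List.Membership.Propositional.Properties
  using (∈-∃++; ∈-++⁻; ∈-++⁺ˡ; ∈-++⁺ʳ; ∈-map⁺; ∈-map⁻; ∈-concatMap⁺; ∈-concatMap⁻; ∈-filter⁺; ∈-filter⁻)
open import Data.List.Properties using (length-++; length-map; map-applyUpTo; map-cong-local; map-∘)
open import Data.List.Relation.Binary.Permutation.Propositional using (_↭_; ↭-refl; ↭-trans; ↭-sym; prep)
open import Data.List.Relation.Binary.Permutation.Propositional.Properties using (shift; filter-↭; ↭-length; drop-∷)
import Data.List.Relation.Binary.Permutation.Propositional.Properties as Perm
open import Data.List.Relation.Binary.Subset.Propositional using (_⊆_)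
open import Data.List.Relation.Unary.All using ([]; _∷_)
import Data.List.Relation.Unary.All as All
open import Data.List.Relation.Unary.All.Properties.Core using (¬Any⇒All¬)
open import Data.List.Relation.Unary.Any using (here; there)
import Data.List.Relation.Unary.Any as Any
open import Data.List.Relation.Unary.AllPairs using ([]; _∷_)
open import Data.List.Relation.Unary.Unique.Propositional using (Unique)
open import Data.List.Relation.Unary.Unique.Propositional.Properties using (Unique[x∷xs]⇒x∉xs)
import Data.List.Relation.Unary.Unique.Propositional.Properties as Unique
open import Data.Maybe using (just; nothing; maybe′; fromMaybe)
open import Data.Maybe.Properties using (just-injective)
open import Data.Nat using (ℕ; zero; suc; pred; _+_; _∸_; _≡ᵇ_; _≤ᵇ_; _≤_; _<_; z≤n; s≤s; _≟_)
open import Data.Nat.ListAction using (sum)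
open import Data.List.Membership.DecPropositional _≟_ using (_∈?_)
open import Data.Nat.ListAction.Properties using (sum-↭)
open import Data.Nat.Properties
open import Data.Nat.Induction using (<-rec)
open import Data.Product using (_×_; _,_; proj₁; proj₂; ∃-syntax)
open import Data.Sum using (_⊎_; inj₁; inj₂)
open import Data.Vec using (Vec; toList)
import Data.Vec as Vec
import Data.Vec.Properties as Vec
open import Function using (_∘_; id; Equivalence)
open import Relation.Binary using (tri<; tri≈; tri>)
open import Relation.Binary.PropositionalEquality hiding ([_])
open import Relation.Nullary using (yes; no)
open import Relation.Nullary.Decidable.Core using (T?)

true≢false : true ≢ false
true≢false ()

≡true⇒T : ∀ {b} → b ≡ true → T b
≡true⇒T = Equivalence.from T-≡

T⇒≡true : ∀ {b} → T b → b ≡ true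
T⇒≡true = Equivalence.to T-≡

≡ᵇ-true⇒≡ : ∀ m n → (m ≡ᵇ n) ≡ true → m ≡ n
≡ᵇ-true⇒≡ m n = ≡ᵇ⇒≡ m n ∘ ≡true⇒T

≡⇒≡ᵇ-true : ∀ {m n} → m ≡ n → (m ≡ᵇ n) ≡ true
≡⇒≡ᵇ-true {m} {n} = T⇒≡true ∘ ≡⇒≡ᵇ m n

≡ᵇ-refl : ∀ m → (m ≡ᵇ m) ≡ true
≡ᵇ-refl m = ≡⇒≡ᵇ-true {m} refl

≢⇒≡ᵇ-false : ∀ m n → m ≢ n → (m ≡ᵇ n) ≡ false
≢⇒≡ᵇ-false m n m≢n with m ≡ᵇ n in eq
... | true  = ⊥-elim (m≢n (≡ᵇ-true⇒≡ m n eq))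
... | false = refl

≡ᵇ-false⇒≢ : ∀ m n → (m ≡ᵇ n) ≡ false → m ≢ n
≡ᵇ-false⇒≢ m .m eq refl = true≢false (trans (sym (≡ᵇ-refl m)) eq)

≤ᵇ-true⇒≤ : ∀ m n → (m ≤ᵇ n) ≡ true → m ≤ n
≤ᵇ-true⇒≤ m n = ≤ᵇ⇒≤ m n ∘ ≡true⇒T

≤⇒≤ᵇ-true : ∀ {m n} → m ≤ n → (m ≤ᵇ n) ≡ true
≤⇒≤ᵇ-true = T⇒≡true ∘ ≤⇒≤ᵇ

∧-trueˡ : ∀ {a b} → a ∧ b ≡ true → a ≡ true
∧-trueˡ {true} _ = refl

∧-trueʳ : ∀ {a b} → a ∧ b ≡ true → b ≡ true
∧-trueʳ {true} eq = eq

∧-true : ∀ {a b} → a ≡ true → b ≡ true → a ∧ b ≡ true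
∧-true refl refl = refl

∨-true⁻ : ∀ {a b} → a ∨ b ≡ true → a ≡ true ⊎ b ≡ true
∨-true⁻ {true}  _  = inj₁ refl
∨-true⁻ {false} eq = inj₂ eq

∨-trueˡ : ∀ {a b} → a ≡ true → a ∨ b ≡ true
∨-trueˡ refl = refl

∨-trueʳ : ∀ {a b} → b ≡ true → a ∨ b ≡ true
∨-trueʳ {true}  _  = refl
∨-trueʳ {false} eq = eq

not-false : ∀ {a} → a ≡ false → not a ≡ true
not-false refl = refl

Bool-≡-by-⇔ : ∀ {a b} → (a ≡ true → b ≡ true) → (b ≡ true → a ≡ true) → a ≡ b
Bool-≡-by-⇔ {true}  {true}  _ _ = refl
Bool-≡-by-⇔ {true}  {false} a⇒b _ = sym (a⇒b refl)
Bool-≡-by-⇔ {false} {true}  _ b⇒a = b⇒a refl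
Bool-≡-by-⇔ {false} {false} _ _ = refl

module _ {A : Set} (p : A → Bool) where

  all-true⁻ : ∀ {xs x} → all p xs ≡ true → x ∈ xs → p x ≡ true
  all-true⁻ {y ∷ ys} eq (here refl) = ∧-trueˡ eq
  all-true⁻ {y ∷ ys} eq (there x∈ys) = all-true⁻ (∧-trueʳ {p y} eq) x∈ys

  all-true⁺ : ∀ xs → (∀ {x} → x ∈ xs → p x ≡ true) → all p xs ≡ true
  all-true⁺ []       _   = refl
  all-true⁺ (y ∷ ys) holds = ∧-true (holds (here refl)) (all-true⁺ ys (holds ∘ there))

  any-true⁻ : ∀ xs → any p xs ≡ true → ∃[ x ] (x ∈ xs × p x ≡ true)
  any-true⁻ (y ∷ ys) eq with ∨-true⁻ {p y} eq
  ... | inj₁ py = y , here refl , py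
  ... | inj₂ rest with any-true⁻ ys rest
  ...   | x , x∈ys , px = x , there x∈ys , px

  any-true⁺ : ∀ {xs x} → x ∈ xs → p x ≡ true → any p xs ≡ true
  any-true⁺ {y ∷ ys} (here refl)  px = ∨-trueˡ px
  any-true⁺ {y ∷ ys} (there x∈ys) px = ∨-trueʳ {p y} (any-true⁺ x∈ys px)

  filterᵇ-∷ : ∀ x xs → filterᵇ p (x ∷ xs) ≡ (if p x then x ∷ filterᵇ p xs else filterᵇ p xs)
  filterᵇ-∷ x xs with p x
  ... | true  = refl
  ... | false = refl

all-true-transfer : ∀ {A B : Set} (p : A → Bool) (q : B → Bool) {xs ys} →
  (∀ {y} → y ∈ ys → ∃[ x ] (x ∈ xs × q y ≡ p x)) → all p xs ≡ true → all q ys ≡ true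
all-true-transfer p q {xs} {ys} match all-p = all-true⁺ q ys λ y∈ →
  let (x , x∈ , qy≡px) = match y∈ in trans qy≡px (all-true⁻ p all-p x∈)

∈-filterᵇ⁻ : ∀ {A : Set} (p : A → Bool) {xs x} → x ∈ filterᵇ p xs → p x ≡ true
∈-filterᵇ⁻ p {xs} x∈ = T⇒≡true (proj₂ (∈-filter⁻ (T? ∘ p) {xs = xs} x∈))

∈-filterᵇ⁺ : ∀ {A : Set} (p : A → Bool) {xs x} → x ∈ xs → p x ≡ true → x ∈ filterᵇ p xs
∈-filterᵇ⁺ p x∈ px = ∈-filter⁺ (T? ∘ p) x∈ (≡true⇒T px)

elemᵇ-true⇒∈ : ∀ {x} xs → elemᵇ x xs ≡ true → x ∈ xs
elemᵇ-true⇒∈ {x} xs eq with any-true⁻ (x ≡ᵇ_) xs eq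
... | y , y∈xs , x≡ᵇy rewrite ≡ᵇ-true⇒≡ x y x≡ᵇy = y∈xs

∈⇒elemᵇ-true : ∀ {x xs} → x ∈ xs → elemᵇ x xs ≡ true
∈⇒elemᵇ-true {x} x∈xs = any-true⁺ (x ≡ᵇ_) x∈xs (≡ᵇ-refl x)

∉⇒elemᵇ-false : ∀ {x} xs → x ∉ xs → elemᵇ x xs ≡ false
∉⇒elemᵇ-false {x} xs x∉xs with elemᵇ x xs in eq
... | true  = ⊥-elim (x∉xs (elemᵇ-true⇒∈ xs eq))
... | false = refl

elemᵇ-false⇒∉ : ∀ {x xs} → elemᵇ x xs ≡ false → x ∉ xs
elemᵇ-false⇒∉ eq x∈xs = true≢false (trans (sym (∈⇒elemᵇ-true x∈xs)) eq)

module _ {A : Set} where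

  countᵇ-map : ∀ {B : Set} (p : B → Bool) (g : A → B) xs → countᵇ p (map g xs) ≡ countᵇ (p ∘ g) xs
  countᵇ-map p g [] = refl
  countᵇ-map p g (x ∷ xs) rewrite filterᵇ-∷ p (g x) (map g xs) | filterᵇ-∷ (p ∘ g) x xs with p (g x)
  ... | true  = cong suc (countᵇ-map p g xs)
  ... | false = countᵇ-map p g xs

  countᵇ-cong-local : ∀ (p q : A → Bool) {xs} → (∀ {x} → x ∈ xs → p x ≡ q x) → countᵇ p xs ≡ countᵇ q xs
  countᵇ-cong-local p q {xs} p≡q = begin
    countᵇ p xs          ≡⟨ countᵇ-map id p xs ⟨
    countᵇ id (map p xs) ≡⟨ cong (countᵇ id) (map-cong-local (All.tabulate p≡q)) ⟩
    countᵇ id (map q xs) ≡⟨ countᵇ-map id q xs ⟩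
    countᵇ q xs          ∎
    where open ≡-Reasoning

  countᵇ-↭ : ∀ (p : A → Bool) {xs ys} → xs ↭ ys → countᵇ p xs ≡ countᵇ p ys
  countᵇ-↭ p = ↭-length ∘ filter-↭ (T? ∘ p)

  sum-indicator≡countᵇ : ∀ (p : A → Bool) xs → sum (map (λ x → if p x then 1 else 0) xs) ≡ countᵇ p xs
  sum-indicator≡countᵇ p [] = refl
  sum-indicator≡countᵇ p (x ∷ xs) rewrite filterᵇ-∷ p x xs with p x
  ... | true  = cong suc (sum-indicator≡countᵇ p xs)
  ... | false = sum-indicator≡countᵇ p xs

  zipWith-map-same : ∀ {B C D : Set} (k : B → C → D) (g : A → B) (h : A → C) xs →
                     zipWith k (map g xs) (map h xs) ≡ map (λ x → k (g x) (h x)) xs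
  zipWith-map-same k g h [] = refl
  zipWith-map-same k g h (x ∷ xs) = cong (k (g x) (h x) ∷_) (zipWith-map-same k g h xs)

  sum-suc : ∀ (g : A → ℕ) xs → sum (map (suc ∘ g) xs) ≡ length xs + sum (map g xs)
  sum-suc g [] = refl
  sum-suc g (x ∷ xs) = cong suc (begin
    g x + sum (map (suc ∘ g) xs)      ≡⟨ cong (g x +_) (sum-suc g xs) ⟩
    g x + (length xs + sum (map g xs)) ≡⟨ +-assoc (g x) _ _ ⟨
    g x + length xs + sum (map g xs)   ≡⟨ cong (_+ sum (map g xs)) (+-comm (g x) (length xs)) ⟩
    length xs + g x + sum (map g xs)   ≡⟨ +-assoc (length xs) _ _ ⟩
    length xs + (g x + sum (map g xs)) ∎)
    where open ≡-Reasoning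

indexOf<length : ∀ {x xs} → x ∈ xs → indexOf x xs < length xs
indexOf<length {x} {y ∷ ys} (here refl) rewrite ≡ᵇ-refl x = s≤s z≤n
indexOf<length {x} {y ∷ ys} (there x∈ys) with x ≡ᵇ y
... | true  = s≤s z≤n
... | false = s≤s (indexOf<length x∈ys)

indexOf-∉ : ∀ {x} xs → x ∉ xs → indexOf x xs ≡ length xs
indexOf-∉ [] _ = refl
indexOf-∉ {x} (y ∷ ys) x∉ rewrite ≢⇒≡ᵇ-false x y (x∉ ∘ here) = cong suc (indexOf-∉ ys (x∉ ∘ there))

indexOf<length⇒∈ : ∀ {x} xs → indexOf x xs < length xs → x ∈ xs
indexOf<length⇒∈ {x} xs lt with x ∈? xs
... | yes x∈xs = x∈xs
... | no  x∉xs = ⊥-elim (<-irrefl (indexOf-∉ xs x∉xs) lt)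

indexOf-++-∈ : ∀ {x} xs ys → x ∈ xs → indexOf x (xs ++ ys) ≡ indexOf x xs
indexOf-++-∈ {x} (z ∷ zs) ys x∈ with x ≡ᵇ z in eq | x∈
... | true  | _            = refl
... | false | here x≡z     = ⊥-elim (≡ᵇ-false⇒≢ x z eq x≡z)
... | false | there x∈zs   = cong suc (indexOf-++-∈ zs ys x∈zs)

indexOf-++-∉ : ∀ {x} xs ys → x ∉ xs → indexOf x (xs ++ ys) ≡ length xs + indexOf x ys
indexOf-++-∉ [] ys _ = refl
indexOf-++-∉ {x} (z ∷ zs) ys x∉ rewrite ≢⇒≡ᵇ-false x z (x∉ ∘ here) = cong suc (indexOf-++-∉ zs ys (x∉ ∘ there))

nth-indexOf : ∀ {x xs} → x ∈ xs → nth xs (indexOf x xs) ≡ x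
nth-indexOf {x} {y ∷ ys} x∈ with x ≡ᵇ y in eq | x∈
... | true  | _           = sym (≡ᵇ-true⇒≡ x y eq)
... | false | here x≡y    = ⊥-elim (≡ᵇ-false⇒≢ x y eq x≡y)
... | false | there x∈ys  = nth-indexOf x∈ys

nth-∈ : ∀ xs {k} → k < length xs → nth xs k ∈ xs
nth-∈ (x ∷ xs) {zero}  _         = here refl
nth-∈ (x ∷ xs) {suc k} (s≤s k<) = there (nth-∈ xs k<)

indexOf-nth : ∀ {xs} → Unique xs → ∀ {k} → k < length xs → indexOf (nth xs k) xs ≡ k
indexOf-nth {x ∷ xs} _ {zero} _ rewrite ≡ᵇ-refl x = refl
indexOf-nth {x ∷ xs} (x∉ ∷ u) {suc k} (s≤s k<)
  rewrite ≢⇒≡ᵇ-false (nth xs k) x (λ eq → All.lookup x∉ (nth-∈ xs k<) (sym eq)) = cong suc (indexOf-nth u k<)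

nth-≤ : ∀ {n} xs k → (∀ {x} → x ∈ xs → x ≤ n) → nth xs k ≤ n
nth-≤ []       k       _   = z≤n
nth-≤ (x ∷ xs) zero    bound = bound (here refl)
nth-≤ (x ∷ xs) (suc k) bound = nth-≤ xs k (bound ∘ there)

nth-map : ∀ (h : ℕ → ℕ) xs {k} → k < length xs → nth (map h xs) k ≡ h (nth xs k)
nth-map h (x ∷ xs) {zero}  _         = refl
nth-map h (x ∷ xs) {suc k} (s≤s k<) = nth-map h xs k<

Vec-map-id-local : ∀ {n} (F : ℕ → ℕ) (v : Vec ℕ n) → (∀ {a} → a ∈ toList v → F a ≡ a) → Vec.map F v ≡ v
Vec-map-id-local F Vec.[]       _     = refl
Vec-map-id-local F (a Vec.∷ v) fixed = cong₂ Vec._∷_ (fixed (here refl)) (Vec-map-id-local F v (fixed ∘ there))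

Unique-∷ : ∀ {A : Set} {x : A} {xs} → x ∉ xs → Unique xs → Unique (x ∷ xs)
Unique-∷ x∉ u = ¬Any⇒All¬ _ x∉ ∷ u

Unique-∷ʳ : ∀ {A : Set} {w : A} xs → Unique xs → w ∉ xs → Unique (xs ++ [ w ])
Unique-∷ʳ [] _ _ = [] ∷ []
Unique-∷ʳ {w = w} (x ∷ xs) (x∉ ∷ u) w∉ = All.tabulate x≢ ∷ Unique-∷ʳ xs u (w∉ ∘ there)
  where
  x≢ : ∀ {y} → y ∈ xs ++ [ w ] → x ≢ y
  x≢ y∈ with ∈-++⁻ xs y∈
  ... | inj₁ y∈xs        = All.lookup x∉ y∈xs
  ... | inj₂ (here refl) = λ x≡w → w∉ (here (sym x≡w))

Unique-nth : ∀ xs → (∀ {c i} → i < length xs → c < i → nth xs c ≢ nth xs i) → Unique xs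
Unique-nth [] _ = []
Unique-nth (x ∷ xs) distinct =
  All.tabulate (λ y∈ x≡y → distinct (s≤s (indexOf<length y∈)) (s≤s z≤n) (trans x≡y (sym (nth-indexOf y∈))))
  ∷ Unique-nth xs (λ i< c<i → distinct (s≤s i<) (s≤s c<i))

module _ {A : Set} where

  private
    ∈-remove : ∀ {z x : A} as bs → z ∈ as ++ x ∷ bs → z ≢ x → z ∈ as ++ bs
    ∈-remove as bs z∈ z≢x with ∈-++⁻ as z∈
    ... | inj₁ z∈as         = ∈-++⁺ˡ z∈as
    ... | inj₂ (here z≡x)   = ⊥-elim (z≢x z≡x)
    ... | inj₂ (there z∈bs) = ∈-++⁺ʳ as z∈bs

    ∈-insert : ∀ {z x : A} as bs → z ∈ as ++ bs → z ∈ as ++ x ∷ bs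
    ∈-insert as bs z∈ with ∈-++⁻ as z∈
    ... | inj₁ z∈as = ∈-++⁺ˡ z∈as
    ... | inj₂ z∈bs = ∈-++⁺ʳ as (there z∈bs)

    Unique-remove : ∀ {x : A} as bs → Unique (as ++ x ∷ bs) → Unique (as ++ bs) × x ∉ as ++ bs
    Unique-remove [] bs (x∉ ∷ u) = u , λ x∈ → All.lookup x∉ x∈ refl
    Unique-remove (a ∷ as) bs (a∉ ∷ u) with Unique-remove as bs u
    ... | u′ , x∉ = All.tabulate (All.lookup a∉ ∘ ∈-insert as bs) ∷ u′ ,
                    λ { (here x≡a) → All.lookup a∉ (∈-++⁺ʳ as (here refl)) (sym x≡a) ; (there x∈) → x∉ x∈ }

    ⊆-remove : ∀ {x : A} {xs} as bs → x ∉ xs → x ∷ xs ⊆ as ++ x ∷ bs → xs ⊆ as ++ bs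
    ⊆-remove as bs x∉xs sub z∈xs = ∈-remove as bs (sub (there z∈xs)) (λ { refl → x∉xs z∈xs })

  Unique-⊆⇒length≤ : ∀ {xs ys : List A} → Unique xs → xs ⊆ ys → length xs ≤ length ys
  Unique-⊆⇒length≤ {[]} _ _ = z≤n
  Unique-⊆⇒length≤ {x ∷ xs} uxs@(_ ∷ u) sub with ∈-∃++ (sub (here refl))
  ... | as , bs , refl = begin
    suc (length xs)        ≤⟨ s≤s (Unique-⊆⇒length≤ u (⊆-remove as bs (Unique[x∷xs]⇒x∉xs uxs) sub)) ⟩
    suc (length (as ++ bs)) ≡⟨ cong suc (length-++ as) ⟩
    suc (length as + length bs) ≡⟨ +-suc (length as) (length bs) ⟨
    length as + length (x ∷ bs) ≡⟨ length-++ as ⟨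
    length (as ++ x ∷ bs) ∎
    where open ≤-Reasoning

  Unique-⊆-⊇⇒↭ : ∀ {xs ys : List A} → Unique xs → Unique ys → xs ⊆ ys → ys ⊆ xs → xs ↭ ys
  Unique-⊆-⊇⇒↭ {[]} {[]} _ _ _ _ = ↭-refl
  Unique-⊆-⊇⇒↭ {[]} {y ∷ ys} _ _ _ sup with sup (here refl)
  ... | ()
  Unique-⊆-⊇⇒↭ {x ∷ xs} uxs@(_ ∷ u) uys sub sup with ∈-∃++ (sub (here refl))
  ... | as , bs , refl with Unique-remove as bs uys
  ... | u′ , x∉ =
    ↭-trans (prep x (Unique-⊆-⊇⇒↭ u u′ (⊆-remove as bs x∉xs sub) sup′)) (↭-sym (shift x as bs))
    where
    x∉xs : x ∉ xs
    x∉xs = Unique[x∷xs]⇒x∉xs uxs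
    sup′ : as ++ bs ⊆ xs
    sup′ z∈ with sup (∈-insert as bs z∈)
    ... | here refl = ⊥-elim (x∉ z∈)
    ... | there z∈xs = z∈xs

length≡-by-mutual-covers : ∀ {A B : Set} {xs : List A} {ys : List B} (g : B → A) (h : A → B) →
  Unique xs → Unique ys → xs ⊆ map g ys → ys ⊆ map h xs → length xs ≡ length ys
length≡-by-mutual-covers {xs = xs} {ys} g h uxs uys xs⊆ ys⊆ = ≤-antisym
  (≤-trans (Unique-⊆⇒length≤ uxs xs⊆) (≤-reflexive (length-map g ys)))
  (≤-trans (Unique-⊆⇒length≤ uys ys⊆) (≤-reflexive (length-map h xs)))

interval : ℕ → ℕ → List ℕ
interval i zero    = []
interval i (suc m) = i ∷ interval (suc i) m

length-interval : ∀ i m → length (interval i m) ≡ m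
length-interval i zero    = refl
length-interval i (suc m) = cong suc (length-interval (suc i) m)

∈-interval⁻ : ∀ {x} i m → x ∈ interval i m → i ≤ x × x < i + m
∈-interval⁻ i (suc m) (here refl) = ≤-refl , m<m+n i (s≤s z≤n)
∈-interval⁻ {x} i (suc m) (there x∈) with ∈-interval⁻ (suc i) m x∈
... | i<x , x< = <⇒≤ i<x , subst (x <_) (sym (+-suc i m)) x<

∈-interval⁺ : ∀ {x} i m → i ≤ x → x < i + m → x ∈ interval i m
∈-interval⁺ i zero i≤x x< = ⊥-elim (<-irrefl refl (<-≤-trans x< (≤-trans (≤-reflexive (+-identityʳ i)) i≤x)))
∈-interval⁺ {x} i (suc m) i≤x x< with i ≟ x
... | yes refl = here refl
... | no  i≢x  = there (∈-interval⁺ (suc i) m (≤∧≢⇒< i≤x i≢x) (subst (x <_) (+-suc i m) x<))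

interval-unique : ∀ i m → Unique (interval i m)
interval-unique i zero    = []
interval-unique i (suc m) =
  Unique-∷ (λ i∈ → <-irrefl refl (proj₁ (∈-interval⁻ (suc i) m i∈))) (interval-unique (suc i) m)

applyUpTo≡interval : ∀ (g : ℕ → ℕ) i m → (∀ k → g k ≡ i + k) → applyUpTo g m ≡ interval i m
applyUpTo≡interval g i zero    _ = refl
applyUpTo≡interval g i (suc m) g≡ =
  cong₂ _∷_ (trans (g≡ 0) (+-identityʳ i)) (applyUpTo≡interval (g ∘ suc) (suc i) m (λ k → trans (g≡ (suc k)) (+-suc i k)))

upTo≡interval : ∀ m → upTo m ≡ interval 0 m
upTo≡interval m = applyUpTo≡interval id 0 m (λ _ → refl)

range≡interval : ∀ a b → range a b ≡ interval a (suc b ∸ a)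
range≡interval a b = trans (map-applyUpTo id (a +_) (suc b ∸ a)) (applyUpTo≡interval (a +_) a (suc b ∸ a) (λ _ → refl))

∈-upTo⁺ : ∀ {v m} → v < m → v ∈ upTo m
∈-upTo⁺ {m = m} v<m = subst (_ ∈_) (sym (upTo≡interval m)) (∈-interval⁺ 0 m z≤n v<m)

∈-upTo⁻ : ∀ {v m} → v ∈ upTo m → v < m
∈-upTo⁻ {m = m} v∈ = proj₂ (∈-interval⁻ 0 m (subst (_ ∈_) (upTo≡interval m) v∈))

interval-suc : ∀ i m → interval (suc i) m ≡ map suc (interval i m)
interval-suc i zero    = refl
interval-suc i (suc m) = cong (suc i ∷_) (interval-suc (suc i) m)

nth-interval : ∀ i m {k} → k < m → nth (interval i m) k ≡ i + k
nth-interval i (suc m) {zero}  _        = sym (+-identityʳ i)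
nth-interval i (suc m) {suc k} (s≤s k<) = trans (nth-interval (suc i) m k<) (sym (+-suc i k))

map-interval-nth : ∀ (g : ℕ → ℕ) xs i → (∀ j → g (i + j) ≡ nth xs j) → map g (interval i (length xs)) ≡ xs
map-interval-nth g []       i _  = refl
map-interval-nth g (x ∷ xs) i g≡ = cong₂ _∷_ (trans (cong g (sym (+-identityʳ i))) (g≡ 0))
  (map-interval-nth g xs (suc i) (λ j → trans (cong g (sym (+-suc i j))) (g≡ (suc j))))

∈-allVecs : ∀ (s : List ℕ) k (v : Vec ℕ k) → (∀ {x} → x ∈ toList v → x ∈ s) → v ∈ allVecs s k
∈-allVecs s zero    Vec.[]       _  = here refl
∈-allVecs s (suc k) (x Vec.∷ v) ⊆s =
  ∈-concatMap⁺ (λ y → map (y Vec.∷_) (allVecs s k))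
    (Any.map (λ { refl → ∈-map⁺ (x Vec.∷_) (∈-allVecs s k v (⊆s ∘ there)) }) (⊆s (here refl)))

allVecs-unique : ∀ (s : List ℕ) k → Unique s → Unique (allVecs s k)
allVecs-unique s zero    _  = [] ∷ []
allVecs-unique s (suc k) us = prefixed s us
  where
  withHead : ℕ → List (Vec ℕ (suc k))
  withHead x = map (x Vec.∷_) (allVecs s k)

  head∈ : ∀ {v} t → v ∈ concatMap withHead t → Vec.head v ∈ t
  head∈ {v} t v∈ = Any.map (λ v∈x → head≡ v∈x) (∈-concatMap⁻ withHead v∈)
    where
    head≡ : ∀ {x} → v ∈ withHead x → Vec.head v ≡ x
    head≡ {x} v∈x with ∈-map⁻ (x Vec.∷_) v∈x
    ... | _ , _ , refl = refl

  prefixed : ∀ t → Unique t → Unique (concatMap withHead t)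
  prefixed []      _             = []
  prefixed (x ∷ t) ut@(_ ∷ ut′) =
    Unique.++⁺ (Unique.map⁺ (proj₂ ∘ Vec.∷-injective) (allVecs-unique s k us)) (prefixed t ut′) disjoint
    where
    disjoint : ∀ {v} → v ∈ withHead x × v ∈ concatMap withHead t → ⊥
    disjoint (v∈x , v∈t) with ∈-map⁻ (x Vec.∷_) v∈x
    ... | w , _ , refl = Unique[x∷xs]⇒x∉xs ut (head∈ t v∈t)

filterᵇ-interval-head : ∀ (p : ℕ → Bool) i m {w ws} → filterᵇ p (interval i m) ≡ w ∷ ws →
  w < i + m × p w ≡ true × (∀ {u} → i ≤ u → u < w → p u ≡ false)
filterᵇ-interval-head p i (suc m) {w} eq rewrite filterᵇ-∷ p i (interval (suc i) m) with p i in pi | eq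
... | true  | refl = m<m+n i (s≤s z≤n) , pi , λ i≤u u<i → ⊥-elim (<-irrefl refl (≤-<-trans i≤u u<i))
... | false | eq′ with filterᵇ-interval-head p (suc i) m eq′
...   | w< , pw , below = subst (w <_) (sym (+-suc i m)) w< , pw , below′
  where
  below′ : ∀ {u} → i ≤ u → u < w → p u ≡ false
  below′ {u} i≤u u<w with i ≟ u
  ... | yes refl = pi
  ... | no  i≢u  = below (≤∧≢⇒< i≤u i≢u) u<w

filterᵇ-interval-[] : ∀ (p : ℕ → Bool) i m → filterᵇ p (interval i m) ≡ [] →
  ∀ {u} → i ≤ u → u < i + m → p u ≡ false
filterᵇ-interval-[] p i zero    _  i≤u u< = ⊥-elim (<-irrefl refl (<-≤-trans u< (≤-trans (≤-reflexive (+-identityʳ i)) i≤u)))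
filterᵇ-interval-[] p i (suc m) eq {u} i≤u u< rewrite filterᵇ-∷ p i (interval (suc i) m) with p i in pi | eq
... | false | eq′ with i ≟ u
...   | yes refl = pi
...   | no  i≢u  = filterᵇ-interval-[] p (suc i) m eq′ (≤∧≢⇒< i≤u i≢u) (subst (u <_) (+-suc i m) u<)

module PriorityFirstSearch {n : ℕ} (f : Vec ℕ n) where

  P : ℕ → ℕ
  P = parentOf f

  Candidate : List ℕ → ℕ → Bool
  Candidate vis w = not (elemᵇ w vis) ∧ any (adjacent f w) vis

  record Invariant (vis : List ℕ) : Set where
    field
      unique        : Unique vis
      bounded       : ∀ {x} → x ∈ vis → x ≤ n
      rooted        : ∃[ r ] (vis ≡ 0 ∷ r)
      parent-closed : ∀ {x} → x ∈ vis → P x ∈ vis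
      parent-first  : ∀ {v} → v ∈ vis → v ≢ 0 → indexOf (P v) vis < indexOf v vis
      -- u was already a candidate when v was chosen, and the smallest candidate is chosen
      smaller-first : ∀ {u v} → 1 ≤ u → u ≤ n → v ∈ vis → u < v →
                      indexOf (P u) vis < indexOf v vis → indexOf u vis < indexOf v vis

  open Invariant

  root∈ : ∀ {vis} → Invariant vis → 0 ∈ vis
  root∈ I with rooted I
  ... | _ , refl = here refl

  nextVertex-just : ∀ vis {w} → nextVertex f vis ≡ just w →
    w ≤ n × Candidate vis w ≡ true × (∀ {u} → u < w → Candidate vis u ≡ false)
  nextVertex-just vis eq with filterᵇ (Candidate vis) (upTo (suc n)) in cands | eq
  ... | w ∷ ws | refl
    with filterᵇ-interval-head (Candidate vis) 0 (suc n)
           (subst (λ l → filterᵇ (Candidate vis) l ≡ w ∷ ws) (upTo≡interval (suc n)) cands)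
  ...   | w< , cw , below = ≤-pred w< , cw , below z≤n

  nextVertex-nothing : ∀ vis → nextVertex f vis ≡ nothing → ∀ {u} → u ≤ n → Candidate vis u ≡ false
  nextVertex-nothing vis eq with filterᵇ (Candidate vis) (upTo (suc n)) in cands | eq
  ... | [] | refl = λ u≤n → filterᵇ-interval-[] (Candidate vis) 0 (suc n)
                      (subst (λ l → filterᵇ (Candidate vis) l ≡ []) (upTo≡interval (suc n)) cands) z≤n (s≤s u≤n)

  candidate⁻ : ∀ {vis} → Invariant vis → ∀ w → Candidate vis w ≡ true → P w ∈ vis × w ∉ vis
  candidate⁻ {vis} I w cw with elemᵇ w vis in w∈? | cw
  ... | false | adj with any-true⁻ (adjacent f w) vis adj
  ...   | x , x∈ , wx with ∨-true⁻ {not (w ≡ᵇ 0) ∧ (P w ≡ᵇ x)} wx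
  ...     | inj₁ Pw≡x = subst (_∈ vis) (sym (≡ᵇ-true⇒≡ (P w) x (∧-trueʳ {not (w ≡ᵇ 0)} Pw≡x))) x∈
                      , elemᵇ-false⇒∉ w∈?
  ...     | inj₂ Px≡w = ⊥-elim (elemᵇ-false⇒∉ w∈?
                          (subst (_∈ vis) (≡ᵇ-true⇒≡ (P x) w (∧-trueʳ {not (x ≡ᵇ 0)} Px≡w)) (parent-closed I x∈)))

  candidate⁺ : ∀ vis {u} → u ∉ vis → u ≢ 0 → P u ∈ vis → Candidate vis u ≡ true
  candidate⁺ vis {u} u∉ u≢0 Pu∈ =
    ∧-true (not-false (∉⇒elemᵇ-false vis u∉))
           (any-true⁺ (adjacent f u) Pu∈ (∨-trueˡ (∧-true (not-false (≢⇒≡ᵇ-false u 0 u≢0)) (≡ᵇ-refl (P u)))))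

  module Extend {vis w} (I : Invariant vis) (w≤n : w ≤ n) (cw : Candidate vis w ≡ true)
                (minimal : ∀ {u} → u < w → Candidate vis u ≡ false) where

    vis′ : List ℕ
    vis′ = vis ++ [ w ]

    Pw∈ : P w ∈ vis
    Pw∈ = proj₁ (candidate⁻ I w cw)

    w∉ : w ∉ vis
    w∉ = proj₂ (candidate⁻ I w cw)

    index-old : ∀ {x} → x ∈ vis → indexOf x vis′ ≡ indexOf x vis
    index-old = indexOf-++-∈ vis [ w ]

    index-new : indexOf w vis′ ≡ length vis
    index-new rewrite indexOf-++-∉ vis [ w ] w∉ | ≡ᵇ-refl w = +-identityʳ (length vis)

    index<length⇒old : ∀ {y} → indexOf y vis′ < length vis → y ∈ vis
    index<length⇒old {y} lt with y ∈? vis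
    ... | yes y∈ = y∈
    ... | no  y∉ = ⊥-elim (<-irrefl refl (<-≤-trans lt (subst (length vis ≤_) (sym (indexOf-++-∉ vis [ w ] y∉)) (m≤m+n _ _))))

    bounded′ : ∀ {x} → x ∈ vis′ → x ≤ n
    bounded′ x∈ with ∈-++⁻ vis x∈
    ... | inj₁ x∈vis     = bounded I x∈vis
    ... | inj₂ (here refl) = w≤n

    rooted′ : ∃[ r ] (vis′ ≡ 0 ∷ r)
    rooted′ with rooted I
    ... | r , refl = r ++ [ w ] , refl

    parent-closed′ : ∀ {x} → x ∈ vis′ → P x ∈ vis′
    parent-closed′ x∈ with ∈-++⁻ vis x∈
    ... | inj₁ x∈vis       = ∈-++⁺ˡ (parent-closed I x∈vis)
    ... | inj₂ (here refl) = ∈-++⁺ˡ Pw∈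

    parent-first′ : ∀ {v} → v ∈ vis′ → v ≢ 0 → indexOf (P v) vis′ < indexOf v vis′
    parent-first′ v∈ v≢0 with ∈-++⁻ vis v∈
    ... | inj₁ v∈vis rewrite index-old (parent-closed I v∈vis) | index-old v∈vis = parent-first I v∈vis v≢0
    ... | inj₂ (here refl) rewrite index-old Pw∈ | index-new = indexOf<length Pw∈

    smaller-first′ : ∀ {u v} → 1 ≤ u → u ≤ n → v ∈ vis′ → u < v →
                     indexOf (P u) vis′ < indexOf v vis′ → indexOf u vis′ < indexOf v vis′
    smaller-first′ {u} {v} 1≤u u≤n v∈ u<v Pu< with ∈-++⁻ vis v∈
    ... | inj₁ v∈vis rewrite index-old v∈vis =
      let Pu∈ = index<length⇒old (<-trans Pu< (indexOf<length v∈vis))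
          u<  = smaller-first I 1≤u u≤n v∈vis u<v (subst (_< indexOf v vis) (index-old Pu∈) Pu<)
      in subst (_< indexOf v vis) (sym (index-old (indexOf<length⇒∈ vis (<-trans u< (indexOf<length v∈vis))))) u<
    ... | inj₂ (here refl) rewrite index-new with u ∈? vis
    ...   | yes u∈ rewrite index-old u∈ = indexOf<length u∈
    ...   | no  u∉ = ⊥-elim (true≢false (trans (sym (candidate⁺ vis u∉ (λ { refl → <-irrefl refl 1≤u }) (index<length⇒old Pu<)))
                                               (minimal u<v)))

    invariant : Invariant vis′
    invariant = record
      { unique        = Unique-∷ʳ vis (unique I) w∉
      ; bounded       = bounded′
      ; rooted        = rooted′
      ; parent-closed = parent-closed′
      ; parent-first  = parent-first′
      ; smaller-first = smaller-first′
      }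

  initial : Invariant (0 ∷ [])
  initial = record
    { unique        = [] ∷ []
    ; bounded       = λ { (here refl) → z≤n }
    ; rooted        = [] , refl
    ; parent-closed = λ { (here refl) → here refl }
    ; parent-first  = λ { (here refl) 0≢0 → ⊥-elim (0≢0 refl) }
    ; smaller-first = λ { 1≤u _ (here refl) u<0 _ → ⊥-elim (<-irrefl refl (≤-<-trans z≤n u<0)) }
    }

  module Exhaustive (P≤n : ∀ v → P v ≤ n) (reaches-root : ∀ {v} → v ≤ n → iter n P v ≡ 0) where

    ancestor-visited : ∀ {vis} → Invariant vis → (∀ {u} → u ≤ n → Candidate vis u ≡ false) →
                       ∀ j {v} → v ≤ n → iter j P v ∈ vis → v ∈ vis
    ancestor-visited I none zero    _   v∈    = v∈
    ancestor-visited {vis} I none (suc j) {v} v≤n anc∈ with v ∈? vis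
    ... | yes v∈ = v∈
    ... | no  v∉ = ⊥-elim (true≢false (trans (sym (candidate⁺ vis v∉ v≢0 Pv∈)) (none v≤n)))
      where
      Pv∈ : P v ∈ vis
      Pv∈ = ancestor-visited I none j (P≤n v) anc∈
      v≢0 : v ≢ 0
      v≢0 refl = v∉ (root∈ I)

    stuck⇒complete : ∀ {vis} → Invariant vis → (∀ {u} → u ≤ n → Candidate vis u ≡ false) → ∀ {v} → v ≤ n → v ∈ vis
    stuck⇒complete I none v≤n = ancestor-visited I none n v≤n (subst (_∈ _) (sym (reaches-root v≤n)) (root∈ I))

    full⇒complete : ∀ {vis} → Invariant vis → length vis ≡ suc n → ∀ {v} → v ≤ n → v ∈ vis
    full⇒complete {vis} I len {v} v≤n with v ∈? vis
    ... | yes v∈ = v∈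
    ... | no  v∉ = ⊥-elim (<-irrefl refl (begin-strict
      suc n                         ≡⟨ len ⟨
      length vis                    <⟨ Unique-⊆⇒length≤ (Unique-∷ v∉ (unique I)) v∷vis⊆ ⟩
      length (interval 0 (suc n))   ≡⟨ length-interval 0 (suc n) ⟩
      suc n                         ∎))
      where
      open ≤-Reasoning
      v∷vis⊆ : v ∷ vis ⊆ interval 0 (suc n)
      v∷vis⊆ (here refl)  = ∈-interval⁺ 0 (suc n) z≤n (s≤s v≤n)
      v∷vis⊆ (there x∈)   = ∈-interval⁺ 0 (suc n) z≤n (s≤s (bounded I x∈))

    search-complete : ∀ k vis → Invariant vis → length vis + k ≡ suc n →
                      Invariant (search f k vis) × (∀ {v} → v ≤ n → v ∈ search f k vis)
    search-complete zero    vis I len = I , full⇒complete I (trans (sym (+-identityʳ _)) len)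
    search-complete (suc k) vis I len with nextVertex f vis in next
    ... | nothing = I , stuck⇒complete I (nextVertex-nothing vis next)
    ... | just w with nextVertex-just vis next
    ...   | w≤n , cw , minimal = search-complete k (vis ++ [ w ]) (Extend.invariant I w≤n cw minimal)
                                   (trans (cong (_+ k) (length-++ vis)) (trans (+-assoc (length vis) 1 k) len))

    weary-complete : Invariant (weary f) × (∀ {v} → v ≤ n → v ∈ weary f)
    weary-complete = search-complete n (0 ∷ []) initial refl

module WearyOrder {n : ℕ} (f : Vec ℕ n) (cayley : isCayley f ≡ true) where

  open PriorityFirstSearch f using (P; module Invariant; module Exhaustive)

  entry≤n : ∀ {p} → p ∈ toList f → p ≤ n
  entry≤n = ≤ᵇ-true⇒≤ _ n ∘ all-true⁻ (_≤ᵇ n) (∧-trueˡ cayley)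

  P≤n : ∀ v → P v ≤ n
  P≤n zero    = z≤n
  P≤n (suc v) = nth-≤ (toList f) v entry≤n

  reaches-root : ∀ {v} → v ≤ n → iter n P v ≡ 0
  reaches-root v≤n = ≡ᵇ-true⇒≡ _ 0
    (all-true⁻ (λ v → iter n P v ≡ᵇ 0) (∧-trueʳ {all (_≤ᵇ n) (toList f)} cayley) (∈-upTo⁺ (s≤s v≤n)))

  W : List ℕ
  W = weary f

  ω : ℕ → ℕ
  ω k = nth W k

  ω⁻¹ : ℕ → ℕ
  ω⁻¹ v = indexOf v W

  open Exhaustive P≤n reaches-root using (weary-complete)
  open Invariant (proj₁ weary-complete)

  W-complete : ∀ {v} → v ≤ n → v ∈ W
  W-complete = proj₂ weary-complete

  W↭vertices : W ↭ interval 0 (suc n)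
  W↭vertices = Unique-⊆-⊇⇒↭ unique (interval-unique 0 (suc n))
    (λ v∈ → ∈-interval⁺ 0 (suc n) z≤n (s≤s (bounded v∈)))
    (λ v∈ → W-complete (≤-pred (proj₂ (∈-interval⁻ 0 (suc n) v∈))))

  length-W : length W ≡ suc n
  length-W = trans (↭-length W↭vertices) (length-interval 0 (suc n))

  map-ω-vertices : map ω (interval 0 (suc n)) ≡ W
  map-ω-vertices = subst (λ m → map ω (interval 0 m) ≡ W) length-W (map-interval-nth ω W 0 (λ _ → refl))

  map-ω-nonroot↭ : map ω (interval 1 n) ↭ interval 1 n
  map-ω-nonroot↭ with rooted
  ... | r , W≡ = subst (_↭ interval 1 n) (sym map-ω≡r) (drop-∷ (subst (_↭ interval 0 (suc n)) W≡ W↭vertices))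
    where
    length-r : length r ≡ n
    length-r = suc-injective (trans (cong length (sym W≡)) length-W)
    map-ω≡r : map ω (interval 1 n) ≡ r
    map-ω≡r = subst (λ m → map ω (interval 1 m) ≡ r) length-r (map-interval-nth ω r 1 (λ j → cong (λ l → nth l (suc j)) W≡))

  ω≤n : ∀ k → ω k ≤ n
  ω≤n k = nth-≤ W k bounded

  ω⁻¹-ω : ∀ {k} → k ≤ n → ω⁻¹ (ω k) ≡ k
  ω⁻¹-ω {k} k≤n = indexOf-nth unique (subst (k <_) (sym length-W) (s≤s k≤n))

  ω-ω⁻¹ : ∀ {v} → v ≤ n → ω (ω⁻¹ v) ≡ v
  ω-ω⁻¹ v≤n = nth-indexOf (W-complete v≤n)

  ω⁻¹≤n : ∀ {v} → v ≤ n → ω⁻¹ v ≤ n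
  ω⁻¹≤n {v} v≤n = ≤-pred (subst (ω⁻¹ v <_) length-W (indexOf<length (W-complete v≤n)))

  ω-root : ω 0 ≡ 0
  ω-root with rooted
  ... | _ , W≡ rewrite W≡ = refl

  ω⁻¹-root : ω⁻¹ 0 ≡ 0
  ω⁻¹-root with rooted
  ... | _ , W≡ rewrite W≡ = refl

  ω⁻¹-injective : ∀ {u v} → u ≤ n → v ≤ n → ω⁻¹ u ≡ ω⁻¹ v → u ≡ v
  ω⁻¹-injective u≤n v≤n eq = trans (sym (ω-ω⁻¹ u≤n)) (trans (cong ω eq) (ω-ω⁻¹ v≤n))

  ω-nonroot : ∀ {k} → k ≤ n → k ≢ 0 → ω k ≢ 0
  ω-nonroot k≤n k≢0 ωk≡0 = k≢0 (trans (sym (ω⁻¹-ω k≤n)) (trans (cong ω⁻¹ ωk≡0) ω⁻¹-root))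

  parent-visited-first : ∀ {v} → v ≤ n → v ≢ 0 → ω⁻¹ (P v) < ω⁻¹ v
  parent-visited-first v≤n = parent-first (W-complete v≤n)

  smaller-visited-first : ∀ {u v} → 1 ≤ u → u ≤ n → v ≤ n → u < v → ω⁻¹ (P u) < ω⁻¹ v → ω⁻¹ u < ω⁻¹ v
  smaller-visited-first 1≤u u≤n v≤n = smaller-first 1≤u u≤n (W-complete v≤n)

record IsFirstFree (n start : ℕ) (taken : List ℕ) (t : ℕ) : Set where
  field
    start≤ : start ≤ t
    ≤n     : t ≤ n
    free   : t ∉ taken
    skipped-taken : ∀ {s} → start ≤ s → s < t → s ∈ taken

firstFree-just⁺ : ∀ n fuel {start t} taken → IsFirstFree n start taken t → t ∸ start < fuel →
                  firstFree n fuel start taken ≡ just t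
firstFree-just⁺ n (suc fuel) {start} {t} taken ff fuel>
  rewrite ≤⇒≤ᵇ-true (≤-trans (IsFirstFree.start≤ ff) (IsFirstFree.≤n ff)) with start ≟ t
... | yes refl rewrite ∉⇒elemᵇ-false taken (IsFirstFree.free ff) = refl
... | no start≢t rewrite ∈⇒elemᵇ-true (IsFirstFree.skipped-taken ff ≤-refl (≤∧≢⇒< (IsFirstFree.start≤ ff) start≢t)) =
  firstFree-just⁺ n fuel taken ff′ (subst (_≤ fuel) (+-∸-assoc 1 start<t) (≤-pred fuel>))
  where
  open IsFirstFree ff
  start<t : start < t
  start<t = ≤∧≢⇒< start≤ start≢t
  ff′ : IsFirstFree n (suc start) taken t
  ff′ = record { start≤ = start<t ; ≤n = ≤n ; free = free ; skipped-taken = skipped-taken ∘ <⇒≤ }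

firstFree-just⁻ : ∀ n fuel start taken {t} → firstFree n fuel start taken ≡ just t → IsFirstFree n start taken t
firstFree-just⁻ n (suc fuel) start taken eq with start ≤ᵇ n in start≤n | eq
... | true | eq′ with elemᵇ start taken in start∈? | eq′
...   | false | refl = record
        { start≤ = ≤-refl ; ≤n = ≤ᵇ-true⇒≤ start n start≤n ; free = elemᵇ-false⇒∉ start∈?
        ; skipped-taken = λ start≤s s<start → ⊥-elim (<-irrefl refl (≤-<-trans start≤s s<start)) }
...   | true  | eq″ = record { start≤ = <⇒≤ start≤ ; ≤n = ≤n ; free = free ; skipped-taken = skipped }
  where
  open IsFirstFree (firstFree-just⁻ n fuel (suc start) taken eq″)
  skipped : ∀ {s} → start ≤ s → s < _ → s ∈ taken
  skipped {s} start≤s s<t with start ≟ s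
  ... | yes refl     = elemᵇ-true⇒∈ taken start∈?
  ... | no  start≢s  = skipped-taken (≤∧≢⇒< start≤s start≢s) s<t

record ParkedCar (n : ℕ) (taken prefs spots : List ℕ) (i : ℕ) : Set where
  field
    pref≤spot    : nth prefs i ≤ nth spots i
    spot≤n       : nth spots i ≤ n
    spot-free    : nth spots i ∉ taken
    spot-new     : ∀ {c} → c < i → nth spots c ≢ nth spots i
    passed-taken : ∀ {s} → nth prefs i ≤ s → s < nth spots i → s ∈ taken ⊎ ∃[ c ] (c < i × nth spots c ≡ s)

parkList-just⁻ : ∀ n taken prefs {spots} → parkList n taken prefs ≡ just spots →
  length spots ≡ length prefs × (∀ {i} → i < length prefs → ParkedCar n taken prefs spots i)
parkList-just⁻ n taken [] refl = refl , λ ()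
parkList-just⁻ n taken (a ∷ as) eq with firstFree n (suc n) a taken in ff | eq
... | just j | eq′ with parkList n (j ∷ taken) as in rest | eq′
...   | just js | refl with parkList-just⁻ n (j ∷ taken) as rest
...     | length≡ , later = cong suc length≡ , car
  where
  open IsFirstFree (firstFree-just⁻ n (suc n) a taken ff)
  car : ∀ {i} → i < suc (length as) → ParkedCar n taken (a ∷ as) (j ∷ js) i
  car {zero} _ = record
    { pref≤spot = start≤ ; spot≤n = ≤n ; spot-free = free ; spot-new = λ ()
    ; passed-taken = λ a≤s s<j → inj₁ (skipped-taken a≤s s<j) }
  car {suc i} (s≤s i<) = record
    { pref≤spot = pref≤spot ; spot≤n = spot≤n ; spot-free = spot-free ∘ there
    ; spot-new = new ; passed-taken = passed }
    where
    open ParkedCar (later i<)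
    new : ∀ {c} → c < suc i → nth (j ∷ js) c ≢ nth js i
    new {zero}  _        j≡ = spot-free (here (sym j≡))
    new {suc c} (s≤s c<) = spot-new c<
    passed : ∀ {s} → nth as i ≤ s → s < nth js i → s ∈ taken ⊎ ∃[ c ] (c < suc i × nth (j ∷ js) c ≡ s)
    passed a≤s s< with passed-taken a≤s s<
    ... | inj₁ (here refl)       = inj₂ (0 , s≤s z≤n , refl)
    ... | inj₁ (there s∈)        = inj₁ s∈
    ... | inj₂ (c , c<i , c≡s)   = inj₂ (suc c , s≤s c<i , c≡s)

-- The folds inside `lucky` and `probes` are local functions that cannot be named; applied
-- with `_` for `fold`, this lemma identifies them with a sum over zipWith.
fold≡sum-zipWith : ∀ (h : ℕ → ℕ → ℕ) (fold : List ℕ → List ℕ → ℕ) →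
  (∀ a as j js → fold (a ∷ as) (j ∷ js) ≡ h a j + fold as js) →
  (∀ js → fold [] js ≡ 0) → (∀ a as → fold (a ∷ as) [] ≡ 0) →
  ∀ as js → fold as js ≡ sum (zipWith h as js)
fold≡sum-zipWith h fold step nil₁ nil₂ []       js       = nil₁ js
fold≡sum-zipWith h fold step nil₁ nil₂ (a ∷ as) []       = nil₂ a as
fold≡sum-zipWith h fold step nil₁ nil₂ (a ∷ as) (j ∷ js) =
  trans (step a as j js) (cong (h a j +_) (fold≡sum-zipWith h fold step nil₁ nil₂ as js))

luckyCar : ℕ → ℕ → ℕ
luckyCar a j = if a ≡ᵇ j then 1 else 0

carDisplacement : ℕ → ℕ → ℕ
carDisplacement a j = j ∸ a

module _ {n : ℕ} (π : Vec ℕ n) where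

  private
    lucky-maybe : lucky π ≡ maybe′ (sum ∘ zipWith luckyCar (toList π)) 0 (parking π)
    lucky-maybe with parking π | fold≡sum-zipWith luckyCar _ (λ _ _ _ _ → refl) (λ _ → refl) (λ _ _ → refl)
    ... | nothing | _     = refl
    ... | just js | fold≡ with toList π
    ...   | as = fold≡ as js

    probes-maybe : probes π ≡ maybe′ (λ js → n + sum (zipWith carDisplacement (toList π) js)) 0 (parking π)
    probes-maybe with parking π | fold≡sum-zipWith carDisplacement _ (λ _ _ _ _ → refl) (λ _ → refl) (λ _ _ → refl)
    ... | nothing | _     = refl
    ... | just js | fold≡ with toList π
    ...   | as = cong (n +_) (fold≡ as js)

    isPF-maybe : isPF π ≡ maybe′ (λ _ → all (λ a → (1 ≤ᵇ a) ∧ (a ≤ᵇ n)) (toList π)) false (parking π)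
    isPF-maybe with parking π
    ... | nothing = refl
    ... | just _  = refl

  module _ {spots : List ℕ} (parks : parking π ≡ just spots) where

    lucky-parking : lucky π ≡ sum (zipWith luckyCar (toList π) spots)
    lucky-parking = trans lucky-maybe (cong (maybe′ _ 0) parks)

    probes-parking : probes π ≡ n + sum (zipWith carDisplacement (toList π) spots)
    probes-parking = trans probes-maybe (cong (maybe′ _ 0) parks)

    isPF-parking : isPF π ≡ all (λ a → (1 ≤ᵇ a) ∧ (a ≤ᵇ n)) (toList π)
    isPF-parking = trans isPF-maybe (cong (maybe′ _ false) parks)

isPF⇒parking-just : ∀ {n} (π : Vec ℕ n) → isPF π ≡ true → ∃[ spots ] (parking π ≡ just spots)
isPF⇒parking-just π isPF≡ with parking π | isPF≡
... | just spots | _ = spots , refl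

toList≡map-parentOf : ∀ {n} (f : Vec ℕ n) → toList f ≡ map (parentOf f) (interval 1 n)
toList≡map-parentOf {n} f = sym (subst (λ m → map (parentOf f) (interval 1 m) ≡ toList f) (Vec.length-toList f)
                                       (map-interval-nth (parentOf f) (toList f) 1 (λ _ → refl)))

module PrefSeqParking {n : ℕ} (f : Vec ℕ n) (cayley : isCayley f ≡ true) where

  open PriorityFirstSearch f using (P)
  open WearyOrder f cayley

  pref : ℕ → ℕ
  pref c = suc (ω⁻¹ (P c))

  toList-prefSeq : toList (prefSeq f) ≡ map pref (interval 1 n)
  toList-prefSeq = trans (Vec.toList-map (suc ∘ ω⁻¹) f)
                         (trans (cong (map (suc ∘ ω⁻¹)) (toList≡map-parentOf f)) (sym (map-∘ (interval 1 n))))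

  record Occupancy (i : ℕ) (taken : List ℕ) : Set where
    field
      only-earlier : ∀ {s} → s ∈ taken → ∃[ c ] (1 ≤ c × c < i × ω⁻¹ c ≡ s)
      all-earlier  : ∀ {c} → 1 ≤ c → c < i → ω⁻¹ c ∈ taken

  module Car {i taken} (1≤i : 1 ≤ i) (i≤n : i ≤ n) (occupancy : Occupancy i taken) where

    open Occupancy occupancy

    i≢0 : i ≢ 0
    i≢0 refl = <-irrefl refl 1≤i

    spot-free : ω⁻¹ i ∉ taken
    spot-free s∈ with only-earlier s∈
    ... | c , _ , c<i , ω⁻¹c≡ = <-irrefl (ω⁻¹-injective (≤-trans (<⇒≤ c<i) i≤n) i≤n ω⁻¹c≡) c<i

    -- a vertex visited between i's parent and i is smaller than i, or the search would have chosen i first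
    passed-taken : ∀ {s} → pref i ≤ s → s < ω⁻¹ i → s ∈ taken
    passed-taken {s} pref≤s s<i with s≤n ← ≤-trans (<⇒≤ s<i) (ω⁻¹≤n i≤n) | <-cmp (ω s) i
    ... | tri< ωs<i _ _ = subst (_∈ taken) (ω⁻¹-ω s≤n) (all-earlier (n≢0⇒n>0 (ω-nonroot s≤n s≢0)) ωs<i)
      where
      s≢0 : s ≢ 0
      s≢0 refl = <-irrefl refl (≤-trans (s≤s z≤n) pref≤s)
    ... | tri≈ _ ωs≡i _ = ⊥-elim (<-irrefl (trans (sym (ω⁻¹-ω s≤n)) (cong ω⁻¹ ωs≡i)) s<i)
    ... | tri> _ _ i<ωs = ⊥-elim (<-asym s<i (subst (ω⁻¹ i <_) (ω⁻¹-ω s≤n)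
            (smaller-visited-first 1≤i i≤n (ω≤n s) i<ωs (subst (ω⁻¹ (P i) <_) (sym (ω⁻¹-ω s≤n)) pref≤s))))

    parks : firstFree n (suc n) (pref i) taken ≡ just (ω⁻¹ i)
    parks = firstFree-just⁺ n (suc n) taken
      (record { start≤ = parent-visited-first i≤n i≢0 ; ≤n = ω⁻¹≤n i≤n ; free = spot-free ; skipped-taken = passed-taken })
      (s≤s (≤-trans (m∸n≤m (ω⁻¹ i) (pref i)) (ω⁻¹≤n i≤n)))

    next : Occupancy (suc i) (ω⁻¹ i ∷ taken)
    next = record { only-earlier = only-earlier′ ; all-earlier = all-earlier′ }
      where
      only-earlier′ : ∀ {s} → s ∈ ω⁻¹ i ∷ taken → ∃[ c ] (1 ≤ c × c < suc i × ω⁻¹ c ≡ s)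
      only-earlier′ (here refl) = i , 1≤i , ≤-refl , refl
      only-earlier′ (there s∈) with only-earlier s∈
      ... | c , 1≤c , c<i , ω⁻¹c≡ = c , 1≤c , m≤n⇒m≤1+n c<i , ω⁻¹c≡
      all-earlier′ : ∀ {c} → 1 ≤ c → c < suc i → ω⁻¹ c ∈ ω⁻¹ i ∷ taken
      all-earlier′ {c} 1≤c c≤i with c ≟ i
      ... | yes refl = here refl
      ... | no  c≢i  = there (all-earlier 1≤c (≤∧≢⇒< (≤-pred c≤i) c≢i))

  parkList-prefs : ∀ m i taken → i + m ≡ suc n → 1 ≤ i → Occupancy i taken →
                   parkList n taken (map pref (interval i m)) ≡ just (map ω⁻¹ (interval i m))
  parkList-prefs zero    i taken _     _   _         = refl
  parkList-prefs (suc m) i taken i+m≡ 1≤i occupancy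
    with i≤n ← subst (i ≤_) (suc-injective (trans (sym (+-suc i m)) i+m≡)) (m≤m+n i m)
    rewrite Car.parks 1≤i i≤n occupancy
          | parkList-prefs m (suc i) (ω⁻¹ i ∷ taken) (trans (sym (+-suc i m)) i+m≡) (m≤n⇒m≤1+n 1≤i) (Car.next 1≤i i≤n occupancy)
    = refl

  parking-prefSeq : parking (prefSeq f) ≡ just (map ω⁻¹ (interval 1 n))
  parking-prefSeq rewrite toList-prefSeq =
    parkList-prefs n 1 [] refl ≤-refl
      (record { only-earlier = λ () ; all-earlier = λ 1≤c c<1 → ⊥-elim (<-irrefl refl (≤-trans c<1 1≤c)) })

module PrefSeqStatistics {n : ℕ} (f : Vec ℕ n) (cayley : isCayley f ≡ true) where

  open PriorityFirstSearch f using (P)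
  open WearyOrder f cayley
  open PrefSeqParking f cayley
  open ≡-Reasoning

  π : Vec ℕ n
  π = prefSeq f

  nonroot : List ℕ
  nonroot = interval 1 n

  ∈-nonroot⁻ : ∀ {i} → i ∈ nonroot → 1 ≤ i × i ≤ n
  ∈-nonroot⁻ i∈ = proj₁ (∈-interval⁻ 1 n i∈) , ≤-pred (proj₂ (∈-interval⁻ 1 n i∈))

  occ-prefSeq : ∀ {v} → v ≤ n → occ π (suc (ω⁻¹ v)) ≡ children f v
  occ-prefSeq {v} v≤n = begin
    countᵇ (_≡ᵇ suc (ω⁻¹ v)) (toList π)
      ≡⟨ cong (countᵇ _) (Vec.toList-map (suc ∘ ω⁻¹) f) ⟩
    countᵇ (_≡ᵇ suc (ω⁻¹ v)) (map (suc ∘ ω⁻¹) (toList f))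
      ≡⟨ countᵇ-map _ (suc ∘ ω⁻¹) (toList f) ⟩
    countᵇ (λ p → ω⁻¹ p ≡ᵇ ω⁻¹ v) (toList f)
      ≡⟨ countᵇ-cong-local _ (_≡ᵇ v) same-rank ⟩
    children f v
      ∎
    where
    same-rank : ∀ {p} → p ∈ toList f → (ω⁻¹ p ≡ᵇ ω⁻¹ v) ≡ (p ≡ᵇ v)
    same-rank {p} p∈ with p ≟ v
    ... | yes refl = trans (≡ᵇ-refl (ω⁻¹ p)) (sym (≡ᵇ-refl p))
    ... | no  p≢v  = trans (≢⇒≡ᵇ-false _ _ (p≢v ∘ ω⁻¹-injective (entry≤n p∈) v≤n))
                           (sym (≢⇒≡ᵇ-false p v p≢v))

  occ-prefSeq-ω : ∀ {j} → j ≤ n → occ π (suc j) ≡ children f (ω j)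
  occ-prefSeq-ω j≤n = trans (cong (occ π ∘ suc) (sym (ω⁻¹-ω j≤n))) (occ-prefSeq (ω≤n _))

  prefSeq-isPF : isPF π ≡ true
  prefSeq-isPF = trans (isPF-parking π parking-prefSeq)
    (subst (λ as → all (λ a → (1 ≤ᵇ a) ∧ (a ≤ᵇ n)) as ≡ true) (sym toList-prefSeq)
           (all-true⁺ _ _ pref-in-range))
    where
    pref-in-range : ∀ {a} → a ∈ map pref nonroot → ((1 ≤ᵇ a) ∧ (a ≤ᵇ n)) ≡ true
    pref-in-range a∈ with ∈-map⁻ pref a∈
    ... | c , c∈ , refl = let (1≤c , c≤n) = ∈-nonroot⁻ c∈ in
      ∧-true refl (≤⇒≤ᵇ-true (≤-trans (parent-visited-first c≤n (λ { refl → <-irrefl refl 1≤c })) (ω⁻¹≤n c≤n)))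

  spots : List ℕ
  spots = map ω⁻¹ nonroot

  lucky-prefSeq : lucky π ≡ psa f
  lucky-prefSeq = begin
    lucky π
      ≡⟨ lucky-parking π parking-prefSeq ⟩
    sum (zipWith luckyCar (toList π) spots)
      ≡⟨ cong (λ as → sum (zipWith luckyCar as spots)) toList-prefSeq ⟩
    sum (zipWith luckyCar (map pref nonroot) (map ω⁻¹ nonroot))
      ≡⟨ cong sum (zipWith-map-same luckyCar pref ω⁻¹ nonroot) ⟩
    sum (map (λ c → luckyCar (pref c) (ω⁻¹ c)) nonroot)
      ≡⟨ sum-indicator≡countᵇ lucky? nonroot ⟩
    countᵇ lucky? nonroot
      ≡⟨ countᵇ-↭ lucky? map-ω-nonroot↭ ⟨
    countᵇ lucky? (map ω nonroot)
      ≡⟨ countᵇ-map lucky? ω nonroot ⟩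
    countᵇ (lucky? ∘ ω) nonroot
      ≡⟨ countᵇ-cong-local _ _ reindex ⟩
    countᵇ (λ i → ptParent f i ≡ᵇ (i ∸ 1)) nonroot
      ≡⟨ cong (countᵇ _) (range≡interval 1 n) ⟨
    psa f
      ∎
    where
    lucky? : ℕ → Bool
    lucky? c = pref c ≡ᵇ ω⁻¹ c
    reindex : ∀ {i} → i ∈ nonroot → lucky? (ω i) ≡ (ptParent f i ≡ᵇ (i ∸ 1))
    reindex {zero}  i∈ = ⊥-elim (<-irrefl refl (proj₁ (∈-nonroot⁻ i∈)))
    reindex {suc i} i∈ rewrite ω⁻¹-ω (proj₂ (∈-nonroot⁻ i∈)) = refl

  probes-prefSeq : probes π ≡ wait f
  probes-prefSeq = begin
    probes π
      ≡⟨ probes-parking π parking-prefSeq ⟩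
    n + sum (zipWith carDisplacement (toList π) spots)
      ≡⟨ cong (λ as → n + sum (zipWith carDisplacement as spots)) toList-prefSeq ⟩
    n + sum (zipWith carDisplacement (map pref nonroot) (map ω⁻¹ nonroot))
      ≡⟨ cong (λ xs → n + sum xs) (zipWith-map-same carDisplacement pref ω⁻¹ nonroot) ⟩
    n + sum (map displacement nonroot)
      ≡⟨ cong (_+ sum (map displacement nonroot)) (length-interval 1 n) ⟨
    length nonroot + sum (map displacement nonroot)
      ≡⟨ sum-suc displacement nonroot ⟨
    sum (map (suc ∘ displacement) nonroot)
      ≡⟨ cong sum (map-cong-local (All.tabulate suc-displacement)) ⟩
    sum (map gap nonroot)
      ≡⟨ sum-↭ (Perm.map⁺ gap map-ω-nonroot↭) ⟨
    sum (map gap (map ω nonroot))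
      ≡⟨ cong sum (map-∘ nonroot) ⟨
    sum (map (gap ∘ ω) nonroot)
      ≡⟨ cong sum (map-cong-local (All.tabulate reindex)) ⟩
    sum (map (λ i → i ∸ ptParent f i) nonroot)
      ≡⟨ cong (λ cs → sum (map (λ i → i ∸ ptParent f i) cs)) (range≡interval 1 n) ⟨
    wait f
      ∎
    where
    displacement gap : ℕ → ℕ
    displacement c = ω⁻¹ c ∸ pref c
    gap c = ω⁻¹ c ∸ ω⁻¹ (P c)
    suc-displacement : ∀ {c} → c ∈ nonroot → suc (displacement c) ≡ gap c
    suc-displacement c∈ = let (1≤c , c≤n) = ∈-nonroot⁻ c∈ in
      sym (+-∸-assoc 1 (parent-visited-first c≤n (λ { refl → <-irrefl refl 1≤c })))
    reindex : ∀ {i} → i ∈ nonroot → gap (ω i) ≡ i ∸ ptParent f i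
    reindex i∈ rewrite ω⁻¹-ω (proj₂ (∈-nonroot⁻ i∈)) = refl

  ones-prefSeq : ones π ≡ degRoot f
  ones-prefSeq = subst (λ k → occ π (suc k) ≡ children f 0) ω⁻¹-root (occ-prefSeq z≤n)

  abs-prefSeq : abs π ≡ leaves f
  abs-prefSeq = begin
    countᵇ unused? (range 1 (suc n))
      ≡⟨ cong (countᵇ unused?) (trans (range≡interval 1 (suc n)) (interval-suc 0 (suc n))) ⟩
    countᵇ unused? (map suc vertices)
      ≡⟨ countᵇ-map unused? suc vertices ⟩
    countᵇ (unused? ∘ suc) vertices
      ≡⟨ countᵇ-cong-local _ (leaf? ∘ ω) reindex ⟩
    countᵇ (leaf? ∘ ω) vertices
      ≡⟨ countᵇ-map leaf? ω vertices ⟨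
    countᵇ leaf? (map ω vertices)
      ≡⟨ cong (countᵇ leaf?) map-ω-vertices ⟩
    countᵇ leaf? W
      ≡⟨ countᵇ-↭ leaf? W↭vertices ⟩
    countᵇ leaf? vertices
      ≡⟨ cong (countᵇ leaf?) (upTo≡interval (suc n)) ⟨
    leaves f
      ∎
    where
    vertices : List ℕ
    vertices = interval 0 (suc n)
    unused? leaf? : ℕ → Bool
    unused? k = occ π k ≡ᵇ 0
    leaf? v = children f v ≡ᵇ 0
    reindex : ∀ {j} → j ∈ vertices → unused? (suc j) ≡ leaf? (ω j)
    reindex j∈ = cong (_≡ᵇ 0) (occ-prefSeq-ω (≤-pred (proj₂ (∈-interval⁻ 0 (suc n) j∈))))

  isCatalan≡isPF02 : isCatalan f ≡ isPF02 π
  isCatalan≡isPF02 rewrite cayley | prefSeq-isPF = Bool-≡-by-⇔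
    (all-true-transfer (zeroOrTwo ∘ children f) (zeroOrTwo ∘ occ π) symbol-from-vertex)
    (all-true-transfer (zeroOrTwo ∘ occ π) (zeroOrTwo ∘ children f) vertex-from-symbol)
    where
    zeroOrTwo : ℕ → Bool
    zeroOrTwo k = (k ≡ᵇ 0) ∨ (k ≡ᵇ 2)
    symbol-from-vertex : ∀ {k} → k ∈ range 1 (suc n) →
                         ∃[ v ] (v ∈ upTo (suc n) × zeroOrTwo (occ π k) ≡ zeroOrTwo (children f v))
    symbol-from-vertex {k} k∈ with ∈-interval⁻ 1 (suc n) (subst (k ∈_) (range≡interval 1 (suc n)) k∈)
    ... | 1≤k , k≤ with k
    ...   | suc j = ω j , ∈-upTo⁺ (s≤s (ω≤n j)) , cong zeroOrTwo (occ-prefSeq-ω (≤-pred (≤-pred k≤)))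
    vertex-from-symbol : ∀ {v} → v ∈ upTo (suc n) →
                         ∃[ k ] (k ∈ range 1 (suc n) × zeroOrTwo (children f v) ≡ zeroOrTwo (occ π k))
    vertex-from-symbol {v} v∈ with v≤n ← ≤-pred (∈-upTo⁻ v∈) =
      suc (ω⁻¹ v) ,
      subst (suc (ω⁻¹ v) ∈_) (sym (range≡interval 1 (suc n))) (∈-interval⁺ 1 (suc n) (s≤s z≤n) (s≤s (s≤s (ω⁻¹≤n v≤n)))) ,
      cong zeroOrTwo (sym (occ-prefSeq v≤n))

isPF-entry-range : ∀ {n} (π : Vec ℕ n) → isPF π ≡ true → ∀ {a} → a ∈ toList π → 1 ≤ a × a ≤ n
isPF-entry-range {n} π isPF≡ {a} a∈ with isPF⇒parking-just π isPF≡
... | _ , parks = let bounds = all-true⁻ _ (trans (sym (isPF-parking π parks)) isPF≡) a∈ in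
  ≤ᵇ-true⇒≤ 1 a (∧-trueˡ bounds) , ≤ᵇ-true⇒≤ a n (∧-trueʳ {1 ≤ᵇ a} bounds)

-- The root is car 0, parked at spot 0.
carAt : List ℕ → ℕ → ℕ
carAt spots zero    = 0
carAt spots (suc s) = suc (indexOf (suc s) spots)

spotOf : List ℕ → ℕ → ℕ
spotOf spots zero    = 0
spotOf spots (suc k) = nth spots k

parkingTree : ∀ {n} → Vec ℕ n → Vec ℕ n
parkingTree π = Vec.map (carAt (fromMaybe [] (parking π)) ∘ pred) π

module ParkingFunction {n : ℕ} (π : Vec ℕ n) (isPF≡ : isPF π ≡ true) where

  prefs : List ℕ
  prefs = toList π

  length-prefs : length prefs ≡ n
  length-prefs = Vec.length-toList π

  spots : List ℕ
  spots = proj₁ (isPF⇒parking-just π isPF≡)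

  parks : parking π ≡ just spots
  parks = proj₂ (isPF⇒parking-just π isPF≡)

  length-spots : length spots ≡ n
  length-spots = trans (proj₁ (parkList-just⁻ n [] prefs parks)) length-prefs

  car : ∀ {i} → i < n → ParkedCar n [] prefs spots i
  car i<n = proj₂ (parkList-just⁻ n [] prefs parks) (subst (_ <_) (sym length-prefs) i<n)

  spot-range : ∀ {x} → x ∈ spots → 1 ≤ x × x ≤ n
  spot-range {x} x∈ = subst (λ y → 1 ≤ y × y ≤ n) (nth-indexOf x∈)
    (≤-trans (proj₁ (isPF-entry-range π isPF≡ (nth-∈ prefs (subst (i <_) (sym length-prefs) i<n)))) pref≤spot , spot≤n)
    where
    i : ℕ
    i = indexOf x spots
    i<n : i < n
    i<n = subst (i <_) length-spots (indexOf<length x∈)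
    open ParkedCar (car i<n)

  spots-unique : Unique spots
  spots-unique = Unique-nth spots λ i< c<i → ParkedCar.spot-new (car (subst (_ <_) length-spots i<)) c<i

  spot-taken : ∀ {s} → 1 ≤ s → s ≤ n → s ∈ spots
  spot-taken {s} 1≤s s≤n with s ∈? spots
  ... | yes s∈ = s∈
  ... | no  s∉ = ⊥-elim (<-irrefl refl (begin-strict
    n                        ≡⟨ length-spots ⟨
    length spots             <⟨ Unique-⊆⇒length≤ (Unique-∷ s∉ spots-unique) s∷spots⊆ ⟩
    length (interval 1 n)    ≡⟨ length-interval 1 n ⟩
    n                        ∎))
    where
    open ≤-Reasoning
    s∷spots⊆ : s ∷ spots ⊆ interval 1 n
    s∷spots⊆ (here refl) = ∈-interval⁺ 1 n 1≤s (s≤s s≤n)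
    s∷spots⊆ (there x∈)  = let (1≤x , x≤n) = spot-range x∈ in ∈-interval⁺ 1 n 1≤x (s≤s x≤n)

  spotOf-range : ∀ {k} → k < n → 1 ≤ spotOf spots (suc k) × spotOf spots (suc k) ≤ n
  spotOf-range k<n = spot-range (nth-∈ spots (subst (_ <_) (sym length-spots) k<n))

  spotOf≤n : ∀ {v} → v ≤ n → spotOf spots v ≤ n
  spotOf≤n {zero}  _   = z≤n
  spotOf≤n {suc k} k<n = proj₂ (spotOf-range k<n)

  carAt≤n : ∀ {s} → s ≤ n → carAt spots s ≤ n
  carAt≤n {zero}  _   = z≤n
  carAt≤n {suc s} s≤n = subst (suc (indexOf (suc s) spots) ≤_) length-spots (indexOf<length (spot-taken (s≤s z≤n) s≤n))

  spotOf-carAt : ∀ {s} → s ≤ n → spotOf spots (carAt spots s) ≡ s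
  spotOf-carAt {zero}  _   = refl
  spotOf-carAt {suc s} s≤n = nth-indexOf (spot-taken (s≤s z≤n) s≤n)

  carAt-spotOf : ∀ {v} → v ≤ n → carAt spots (spotOf spots v) ≡ v
  carAt-spotOf {zero}  _   = refl
  carAt-spotOf {suc k} k<n with nth spots k | spotOf-range k<n | indexOf-nth spots-unique (subst (k <_) (sym length-spots) k<n)
  ... | suc s | _ | index≡ = cong suc index≡

  prefOf : ℕ → ℕ
  prefOf zero    = 0
  prefOf (suc k) = nth prefs k

  prefOf-range : ∀ {k} → k < n → 1 ≤ prefOf (suc k) × prefOf (suc k) ≤ spotOf spots (suc k)
  prefOf-range k<n = proj₁ (isPF-entry-range π isPF≡ (nth-∈ prefs (subst (_ <_) (sym length-prefs) k<n)))
                   , ParkedCar.pref≤spot (car k<n)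

  passed-spots-taken : ∀ {v} → 1 ≤ v → v ≤ n → ∀ {s} → prefOf v ≤ s → s < spotOf spots v →
                       ∃[ u ] (1 ≤ u × u < v × spotOf spots u ≡ s)
  passed-spots-taken {suc k} _ k<n pref≤s s<spot with ParkedCar.passed-taken (car k<n) pref≤s s<spot
  ... | inj₂ (c , c<k , spot≡s) = suc c , s≤s z≤n , s≤s c<k , spot≡s

  tree : Vec ℕ n
  tree = Vec.map (carAt spots ∘ pred) π

  parkingTree≡tree : parkingTree π ≡ tree
  parkingTree≡tree = cong (λ outcome → Vec.map (carAt (fromMaybe [] outcome) ∘ pred) π) parks

  tree-entry≤n : ∀ {p} → p ∈ toList tree → p ≤ n
  tree-entry≤n p∈ with ∈-map⁻ (carAt spots ∘ pred) (subst (_ ∈_) (Vec.toList-map (carAt spots ∘ pred) π) p∈)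
  ... | a , a∈ , refl = carAt≤n (≤-trans pred[n]≤n (proj₂ (isPF-entry-range π isPF≡ a∈)))

  P : ℕ → ℕ
  P = parentOf tree

  P≤n : ∀ v → P v ≤ n
  P≤n zero    = z≤n
  P≤n (suc k) = nth-≤ (toList tree) k tree-entry≤n

  spotOf-P : ∀ {k} → k < n → spotOf spots (P (suc k)) ≡ pred (prefOf (suc k))
  spotOf-P {k} k<n = begin
    spotOf spots (nth (toList tree) k)
      ≡⟨ cong (λ l → spotOf spots (nth l k)) (Vec.toList-map _ π) ⟩
    spotOf spots (nth (map (carAt spots ∘ pred) prefs) k)
      ≡⟨ cong (spotOf spots) (nth-map _ prefs (subst (k <_) (sym length-prefs) k<n)) ⟩
    spotOf spots (carAt spots (pred (prefOf (suc k))))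
      ≡⟨ spotOf-carAt (≤-trans pred[n]≤n (≤-trans pref≤spot (proj₂ (spotOf-range k<n)))) ⟩
    pred (prefOf (suc k))
      ∎
    where
    open ≡-Reasoning
    pref≤spot : prefOf (suc k) ≤ spotOf spots (suc k)
    pref≤spot = proj₂ (prefOf-range k<n)

  spotOf-P< : ∀ {v} → 1 ≤ v → v ≤ n → spotOf spots (P v) < spotOf spots v
  spotOf-P< {suc k} _ k<n with prefOf (suc k) | prefOf-range k<n | spotOf-P k<n
  ... | suc a | _ , pref≤spot | spot-P≡ = subst (_< spotOf spots (suc k)) (sym spot-P≡) pref≤spot

  prefOf≤ : ∀ {v K} → 1 ≤ v → v ≤ n → spotOf spots (P v) < K → prefOf v ≤ K
  prefOf≤ {suc k} _ k<n spot-P<K with prefOf (suc k) | prefOf-range k<n | spotOf-P k<n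
  ... | suc a | _ | spot-P≡ = subst (_< _) spot-P≡ spot-P<K

  reaches-root-within : ∀ k {v} → v ≤ n → spotOf spots v ≤ k → iter k P v ≡ 0
  reaches-root-within zero    v≤n spot≤0 = trans (sym (carAt-spotOf v≤n)) (cong (carAt spots) (n≤0⇒n≡0 spot≤0))
  reaches-root-within (suc k) {zero}  _   _        = reaches-root-within k z≤n z≤n
  reaches-root-within (suc k) {suc v} v<n spot≤k+1 =
    reaches-root-within k (P≤n (suc v)) (≤-pred (≤-trans (spotOf-P< (s≤s z≤n) v<n) spot≤k+1))

  tree-isCayley : isCayley tree ≡ true
  tree-isCayley = ∧-true (all-true⁺ _ (toList tree) (≤⇒≤ᵇ-true ∘ tree-entry≤n))
    (all-true⁺ _ (upTo (suc n)) λ v∈ → let v≤n = ≤-pred (∈-upTo⁻ v∈) in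
      ≡⇒≡ᵇ-true (reaches-root-within n v≤n (spotOf≤n v≤n)))

  module W = WearyOrder tree tree-isCayley

  module WearyStep {K} (1≤K : 1 ≤ K) (K≤n : K ≤ n) (earlier : ∀ {j} → j < K → W.ω j ≡ carAt spots j) where

    visited-before⇒parked-before : ∀ {u} → u ≤ n → W.ω⁻¹ u < K → spotOf spots u < K
    visited-before⇒parked-before {u} u≤n ω⁻¹u<K = subst (λ x → spotOf spots x < K) (W.ω-ω⁻¹ u≤n)
      (subst (_< K) (sym (trans (cong (spotOf spots) (earlier ω⁻¹u<K)) (spotOf-carAt (W.ω⁻¹≤n u≤n)))) ω⁻¹u<K)

    parked-before⇒visited-before : ∀ {u} → u ≤ n → spotOf spots u < K → W.ω⁻¹ u < K
    parked-before⇒visited-before {u} u≤n spot<K = subst (λ x → W.ω⁻¹ x < K) (carAt-spotOf u≤n)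
      (subst (_< K) (sym (trans (cong W.ω⁻¹ (sym (earlier spot<K))) (W.ω⁻¹-ω (spotOf≤n u≤n)))) spot<K)

    w c : ℕ
    w = W.ω K
    c = carAt spots K

    w≤n : w ≤ n
    w≤n = W.ω≤n K

    c≤n : c ≤ n
    c≤n = carAt≤n K≤n

    1≤w : 1 ≤ w
    1≤w = n≢0⇒n>0 (W.ω-nonroot K≤n (λ { refl → <-irrefl refl 1≤K }))

    1≤c : 1 ≤ c
    1≤c = n≢0⇒n>0 λ c≡0 → <-irrefl (trans (sym (cong (spotOf spots) c≡0)) (spotOf-carAt K≤n)) 1≤K

    K≤spot-w : K ≤ spotOf spots w
    K≤spot-w = ≮⇒≥ λ spot<K → <-irrefl (W.ω⁻¹-ω K≤n) (parked-before⇒visited-before w≤n spot<K)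

    pref-w≤K : prefOf w ≤ K
    pref-w≤K = prefOf≤ 1≤w w≤n (visited-before⇒parked-before (P≤n w)
                 (subst (W.ω⁻¹ (P w) <_) (W.ω⁻¹-ω K≤n) (W.parent-visited-first w≤n (λ w≡0 → <-irrefl (sym w≡0) 1≤w))))

    K≤ω⁻¹c : K ≤ W.ω⁻¹ c
    K≤ω⁻¹c = ≮⇒≥ λ ω⁻¹c<K → <-irrefl (spotOf-carAt K≤n) (visited-before⇒parked-before c≤n ω⁻¹c<K)

    parent-c-visited-before : W.ω⁻¹ (P c) < K
    parent-c-visited-before = parked-before⇒visited-before (P≤n c)
      (subst (spotOf spots (P c) <_) (spotOf-carAt K≤n) (spotOf-P< 1≤c c≤n))

    -- If w < c, car w passed spot K, so an earlier car than w parked there; but that car is c.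
    -- If c < w, the parent of c was visited before step K, so the search would have chosen c over w.
    ω≡carAt : w ≡ c
    ω≡carAt with <-cmp w c
    ... | tri≈ _ w≡c _ = w≡c
    ... | tri< w<c _ _ with passed-spots-taken 1≤w w≤n pref-w≤K (≤∧≢⇒< K≤spot-w K≢spot-w)
      where
      K≢spot-w : K ≢ spotOf spots w
      K≢spot-w K≡spot = <-irrefl (sym (trans (cong (carAt spots) K≡spot) (carAt-spotOf w≤n))) w<c
    ...   | u , _ , u<w , spot-u≡K = ⊥-elim (<-asym w<c (subst (_< w) u≡c u<w))
      where
      u≡c : u ≡ c
      u≡c = trans (sym (carAt-spotOf (≤-trans (<⇒≤ u<w) w≤n))) (cong (carAt spots) spot-u≡K)
    ω≡carAt | tri> _ _ c<w = ⊥-elim (<-irrefl refl (≤-<-trans K≤ω⁻¹c (subst (W.ω⁻¹ c <_) (W.ω⁻¹-ω K≤n)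
      (W.smaller-visited-first 1≤c c≤n w≤n c<w (subst (W.ω⁻¹ (P c) <_) (sym (W.ω⁻¹-ω K≤n)) parent-c-visited-before)))))

  ω≡carAt : ∀ K → K ≤ n → W.ω K ≡ carAt spots K
  ω≡carAt = <-rec (λ K → K ≤ n → W.ω K ≡ carAt spots K) step
    where
    step : ∀ K → (∀ {j} → j < K → j ≤ n → W.ω j ≡ carAt spots j) → K ≤ n → W.ω K ≡ carAt spots K
    step zero    _       _   = W.ω-root
    step (suc k) earlier K≤n = WearyStep.ω≡carAt (s≤s z≤n) K≤n (λ j<K → earlier j<K (≤-trans (<⇒≤ j<K) K≤n))

  ω⁻¹≡spotOf : ∀ {v} → v ≤ n → W.ω⁻¹ v ≡ spotOf spots v
  ω⁻¹≡spotOf {v} v≤n = begin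
    W.ω⁻¹ v                                   ≡⟨ cong W.ω⁻¹ (carAt-spotOf v≤n) ⟨
    W.ω⁻¹ (carAt spots (spotOf spots v))      ≡⟨ cong W.ω⁻¹ (ω≡carAt _ (spotOf≤n v≤n)) ⟨
    W.ω⁻¹ (W.ω (spotOf spots v))              ≡⟨ W.ω⁻¹-ω (spotOf≤n v≤n) ⟩
    spotOf spots v                            ∎
    where open ≡-Reasoning

  prefSeq-tree : prefSeq tree ≡ π
  prefSeq-tree = trans (sym (Vec.map-∘ (suc ∘ W.ω⁻¹) (carAt spots ∘ pred) π)) (Vec-map-id-local _ π pref-recovered)
    where
    pref-recovered : ∀ {a} → a ∈ prefs → suc (W.ω⁻¹ (carAt spots (pred a))) ≡ a
    pref-recovered {a} a∈ with isPF-entry-range π isPF≡ a∈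
    ... | 1≤a , a≤n with a
    ...   | suc a′ with a′≤n ← ≤-trans (n≤1+n a′) a≤n = cong suc (trans (ω⁻¹≡spotOf (carAt≤n a′≤n)) (spotOf-carAt a′≤n))

module _ {n : ℕ} (f : Vec ℕ n) (cayley : isCayley f ≡ true) where

  open WearyOrder f cayley
  open PrefSeqParking f cayley using (parking-prefSeq)
  open PrefSeqStatistics f cayley using (prefSeq-isPF)

  parkingTree-prefSeq : parkingTree (prefSeq f) ≡ f
  parkingTree-prefSeq = begin
    parkingTree (prefSeq f)                               ≡⟨ PF.parkingTree≡tree ⟩
    Vec.map (carAt PF.spots ∘ pred) (prefSeq f)           ≡⟨ Vec.map-∘ (carAt PF.spots ∘ pred) (suc ∘ ω⁻¹) f ⟨
    Vec.map (carAt PF.spots ∘ ω⁻¹) f                      ≡⟨ Vec-map-id-local _ f parent-recovered ⟩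
    f                                                     ∎
    where
    open ≡-Reasoning
    module PF = ParkingFunction (prefSeq f) prefSeq-isPF
    spots≡ : PF.spots ≡ map ω⁻¹ (interval 1 n)
    spots≡ = just-injective (trans (sym PF.parks) parking-prefSeq)
    spotOf≡ω⁻¹ : ∀ {v} → v ≤ n → spotOf PF.spots v ≡ ω⁻¹ v
    spotOf≡ω⁻¹ {zero}  _   = sym ω⁻¹-root
    spotOf≡ω⁻¹ {suc k} k<n = begin
      nth PF.spots k                       ≡⟨ cong (λ s → nth s k) spots≡ ⟩
      nth (map ω⁻¹ (interval 1 n)) k       ≡⟨ nth-map ω⁻¹ (interval 1 n) (subst (k <_) (sym (length-interval 1 n)) k<n) ⟩
      ω⁻¹ (nth (interval 1 n) k)           ≡⟨ cong ω⁻¹ (nth-interval 1 n k<n) ⟩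
      ω⁻¹ (suc k)                          ∎
    parent-recovered : ∀ {p} → p ∈ toList f → carAt PF.spots (ω⁻¹ p) ≡ p
    parent-recovered p∈ = trans (cong (carAt PF.spots) (sym (spotOf≡ω⁻¹ (entry≤n p∈)))) (PF.carAt-spotOf (entry≤n p∈))

  prefSeq-entry-range : ∀ {a} → a ∈ toList (prefSeq f) → a ∈ range 1 n
  prefSeq-entry-range a∈ = let (1≤a , a≤n) = isPF-entry-range (prefSeq f) prefSeq-isPF a∈ in
    subst (_ ∈_) (sym (range≡interval 1 n)) (∈-interval⁺ 1 n 1≤a (s≤s a≤n))

catalan⇒prefSeq-isPF02 : ∀ {n} (f : Vec ℕ n) → isCatalan f ≡ true → isPF02 (prefSeq f) ≡ true
catalan⇒prefSeq-isPF02 f catalan = trans (sym (PrefSeqStatistics.isCatalan≡isPF02 f (∧-trueˡ catalan))) catalan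

isPF02⇒catalan-preimage : ∀ {n} (π : Vec ℕ n) → isPF02 π ≡ true → ∃[ f ] (isCatalan f ≡ true × prefSeq f ≡ π)
isPF02⇒catalan-preimage π pf02 =
  tree , trans (trans (isCatalan≡isPF02 tree tree-isCayley) (cong isPF02 prefSeq-tree)) pf02 , prefSeq-tree
  where
  open ParkingFunction π (∧-trueˡ pf02)
  open PrefSeqStatistics using (isCatalan≡isPF02)

catalanWith : ℕ → ℕ → ℕ → ℕ → ∀ {n} → Vec ℕ n → Bool
catalanWith a b c d f = isCatalan f ∧ (wait f ≡ᵇ a) ∧ (psa f ≡ᵇ b) ∧ (degRoot f ≡ᵇ c) ∧ (leaves f ≡ᵇ d)

pf02With : ℕ → ℕ → ℕ → ℕ → ∀ {n} → Vec ℕ n → Bool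
pf02With a b c d π = isPF02 π ∧ (probes π ≡ᵇ a) ∧ (lucky π ≡ᵇ b) ∧ (ones π ≡ᵇ c) ∧ (abs π ≡ᵇ d)

catalanWith≡pf02With-prefSeq : ∀ {n} a b c d (f : Vec ℕ n) → isCayley f ≡ true →
                               catalanWith a b c d f ≡ pf02With a b c d (prefSeq f)
catalanWith≡pf02With-prefSeq a b c d f cayley =
  cong₂ _∧_ isCatalan≡isPF02
    (cong₂ _∧_ (cong (_≡ᵇ a) (sym probes-prefSeq))
      (cong₂ _∧_ (cong (_≡ᵇ b) (sym lucky-prefSeq))
        (cong₂ _∧_ (cong (_≡ᵇ c) (sym ones-prefSeq)) (cong (_≡ᵇ d) (sym abs-prefSeq)))))
  where open PrefSeqStatistics f cayley

count-catalanWith≡count-pf02With : ∀ n a b c d →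
  countᵇ (catalanWith a b c d) (allParentMaps n) ≡ countᵇ (pf02With a b c d) (allPrefSeqs n)
count-catalanWith≡count-pf02With n a b c d =
  length≡-by-mutual-covers parkingTree prefSeq
    (Unique.filter⁺ (T? ∘ p) (allVecs-unique _ n (subst Unique (sym (upTo≡interval (suc n))) (interval-unique 0 (suc n)))))
    (Unique.filter⁺ (T? ∘ q) (allVecs-unique _ n (subst Unique (sym (range≡interval 1 n)) (interval-unique 1 n))))
    tree-covered parking-covered
  where
  p q : Vec ℕ n → Bool
  p = catalanWith a b c d
  q = pf02With a b c d

  tree-covered : filterᵇ p (allParentMaps n) ⊆ map parkingTree (filterᵇ q (allPrefSeqs n))
  tree-covered {f} f∈ = subst (_∈ map parkingTree _) (parkingTree-prefSeq f cayley) (∈-map⁺ parkingTree prefSeq∈)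
    where
    pf : p f ≡ true
    pf = ∈-filterᵇ⁻ p {allParentMaps n} f∈
    cayley : isCayley f ≡ true
    cayley = ∧-trueˡ (∧-trueˡ {isCatalan f} pf)
    prefSeq∈ : prefSeq f ∈ filterᵇ q (allPrefSeqs n)
    prefSeq∈ = ∈-filterᵇ⁺ q (∈-allVecs _ n (prefSeq f) (prefSeq-entry-range f cayley))
                          (trans (sym (catalanWith≡pf02With-prefSeq a b c d f cayley)) pf)

  parking-covered : filterᵇ q (allPrefSeqs n) ⊆ map prefSeq (filterᵇ p (allParentMaps n))
  parking-covered {π} π∈ = subst (_∈ map prefSeq _) prefSeq-tree (∈-map⁺ prefSeq tree∈)
    where
    qπ : q π ≡ true
    qπ = ∈-filterᵇ⁻ q {allPrefSeqs n} π∈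
    open ParkingFunction π (∧-trueˡ (∧-trueˡ {isPF02 π} qπ))
    tree∈ : tree ∈ filterᵇ p (allParentMaps n)
    tree∈ = ∈-filterᵇ⁺ p (∈-allVecs _ n tree (λ x∈ → ∈-upTo⁺ (s≤s (tree-entry≤n x∈))))
                       (trans (catalanWith≡pf02With-prefSeq a b c d tree tree-isCayley) (trans (cong q prefSeq-tree) qπ))

corollary4p5 : ((n : ℕ) → (π : Vec ℕ n) →
    (isPF02 π ≡ true → ∃[ f ] (isCatalan f ≡ true × prefSeq f ≡ π)) ×
    ((f : Vec ℕ n) → isCatalan f ≡ true → prefSeq f ≡ π → isPF02 π ≡ true))
    ×
    ((n a b c d : ℕ) →
    countᵇ (λ f → isCatalan f ∧ (wait f ≡ᵇ a) ∧ (psa f ≡ᵇ b) ∧ (degRoot f ≡ᵇ c) ∧ (leaves f ≡ᵇ d)) (allParentMaps n)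
    ≡ countᵇ (λ π → isPF02 π ∧ (probes π ≡ᵇ a) ∧ (lucky π ≡ᵇ b) ∧ (ones π ≡ᵇ c) ∧ (abs π ≡ᵇ d)) (allPrefSeqs n))
corollary4p5 =
  (λ n π → isPF02⇒catalan-preimage π , λ { f catalan refl → catalan⇒prefSeq-isPF02 f catalan }) ,
  count-catalanWith≡count-pf02With
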